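{- Let $m\geq 1$ be an integer, and let $G$ be a connected $\{K_{1,3},B_{1,m}\}$-free graph. Then $G$ is not $P_{\max\{3m,m+4\}}$-free if and only if $G\in\mathcal{P}(\max\{3m,m+4\})$.
   Context: All graphs are finite and simple. A graph is $\mathcal{F}$-free if it contains no member of $\mathcal{F}$ as an induced subgraph. $K_{1,3}$ is the star with three leaves, $P_n$ is the path on $n$ vertices. For $m\geq 1$, $B_{1,m}$ is the graph obtained from a triangle $abc$ by adding a new vertex adjacent only to $a$ and a new path $q_1q_2\cdots q_m$ with $q_1$ adjacent to $b$ (and no other new edges). For an integer $l\geq 5$ and pairwise vertex-disjoint nonempty cliques $L_1,\dots,L_l$, the fat $l$-path $F_p(L_1,\dots,L_l)$ is the graph on $L_1\cup\dots\cup L_l$ in which each $L_i$ is a clique, every vertex of $L_i$ is adjacent to every vertex of $L_{i+1}$ for $1\leq i\leq l-1$, and there are no other edges. For pairwise vertex-disjoint nonempty cliques $L_0,\dots,L_l$, the fat $l$-cycle $F_c(L_0,\dots,L_l)$ is the graph on $L_0\cup\dots\cup L_l$ in which each $L_i$ is a clique, every vertex of $L_i$ is adjacent to every vertex of $L_{i+1}$ for $0\leq i\leq l$ (indices modulo $l+1$), and there are no other edges. For $l\geq 5$, $\mathcal{P}(l)$ denotes the family of all fat $i$-paths and fat $i$-cycles for all $i\geq l$ (membership up to isomorphism). -}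

module Defs where

open import Data.Nat using (ℕ; zero; suc; _+_; _*_; _≤_; _⊔_)
open import Data.Nat as ℕ using ()
open import Data.Fin using (Fin; toℕ; _≟_)
open import Data.Bool using (Bool; true; false; _∧_; _∨_; not)
open import Data.Bool.Properties using (∨-comm)
open import Data.Product using (Σ; _×_; _,_; ∃)
open import Data.Sum using (_⊎_)
open import Relation.Nullary using (¬_; yes; no)
open import Relation.Nullary.Decidable using (⌊_⌋)
open import Relation.Binary.PropositionalEquality using (_≡_; _≢_; refl; sym; cong)
open import Function.Definitions using (Injective; Surjective)
open import Function.Bundles using (_⇔_)

record Graph : Set where
  field
    n     : ℕ
    adj   : Fin n → Fin n → Bool
    adj-sym : ∀ u v → adj u v ≡ adj v u
    irrefl : ∀ u → adj u u ≡ false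
open Graph public

private
  dec-sym : ∀ {n} (i j : Fin n) → ⌊ i ≟ j ⌋ ≡ ⌊ j ≟ i ⌋
  dec-sym i j with i ≟ j | j ≟ i
  ... | yes _ | yes _ = refl
  ... | no _  | no _  = refl
  ... | yes p | no q  with q (sym p)
  ... | ()
  dec-sym i j | no q | yes p with q (sym p)
  ... | ()

  dec-refl : ∀ {n} (i : Fin n) → ⌊ i ≟ i ⌋ ≡ true
  dec-refl i with i ≟ i
  ... | yes _ = refl
  ... | no q with q refl
  ... | ()

mkGraph : (k : ℕ) → (Fin k → Fin k → Bool) → Graph
mkGraph k e = record
  { n = k
  ; adj = λ i j → not ⌊ i ≟ j ⌋ ∧ (e i j ∨ e j i)
  ; adj-sym = λ i j → Relation.Binary.PropositionalEquality.cong₂ _∧_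
                    (cong not (dec-sym i j)) (∨-comm (e i j) (e j i))
  ; irrefl = λ i → Relation.Binary.PropositionalEquality.cong (λ b → not b ∧ (e i i ∨ e i i)) (dec-refl i)
  }
  where open import Relation.Binary.PropositionalEquality using (cong₂)

InducedSub : Graph → Graph → Set
InducedSub H G =
  Σ (Fin (n H) → Fin (n G)) λ f →
    Injective _≡_ _≡_ f × (∀ u v → adj G (f u) (f v) ≡ adj H u v)

Free : Graph → Graph → Set
Free G H = ¬ InducedSub H G

data Reachable (G : Graph) : Fin (n G) → Fin (n G) → Set where
  here : ∀ {u} → Reachable G u u
  step : ∀ {u w v} → adj G u w ≡ true → Reachable G w v → Reachable G u v

Connected : Graph → Set
Connected G = ∀ u v → Reachable G u v

K13 : Graph
K13 = mkGraph 4 (λ i j → (toℕ i ℕ.≡ᵇ 0) ∧ not (toℕ j ℕ.≡ᵇ 0))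

Path : ℕ → Graph
Path k = mkGraph k (λ i j → toℕ j ℕ.≡ᵇ suc (toℕ i))

-- B_{1,m} on Fin (4 + m): 0 = a, 1 = b, 2 = c, 3 = pendant at a,
-- 4 + t = q_{t+1} (t = 0,…,m-1).  Edges: ab, ac, bc, a3, b q_1, q_t q_{t+1}.
B1 : ℕ → Graph
B1 m = mkGraph (4 + m) (λ i j → bE (toℕ i) (toℕ j))
  where
    bE : ℕ → ℕ → Bool
    bE 0 1 = true
    bE 0 2 = true
    bE 1 2 = true
    bE 0 3 = true
    bE 1 4 = true
    bE (suc (suc (suc (suc t)))) j = j ℕ.≡ᵇ (5 + t)
    bE _ _ = false

NearP : ∀ {k} → Fin k → Fin k → Set
NearP a b = toℕ a ≡ toℕ b ⊎ suc (toℕ a) ≡ toℕ b ⊎ toℕ a ≡ suc (toℕ b)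

NearC : ∀ {k} → Fin (suc k) → Fin (suc k) → Set
NearC {k} a b = NearP a b ⊎ (toℕ a ≡ 0 × toℕ b ≡ k) ⊎ (toℕ a ≡ k × toℕ b ≡ 0)

-- G is (isomorphic to) a fat i-path: its vertex set is partitioned into
-- nonempty blocks L_1,…,L_i (block map onto Fin i); two distinct vertices
-- are adjacent iff their blocks are equal or consecutive.
IsFatPath : ℕ → Graph → Set
IsFatPath i G =
  Σ (Fin (n G) → Fin i) λ blk →
    Surjective _≡_ _≡_ blk ×
    (∀ u v → u ≢ v → (adj G u v ≡ true ⇔ NearP (blk u) (blk v)))

-- G is (isomorphic to) a fat i-cycle with blocks L_0,…,L_i.
IsFatCycle : ℕ → Graph → Set
IsFatCycle i G =
  Σ (Fin (n G) → Fin (suc i)) λ blk →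
    Surjective _≡_ _≡_ blk ×
    (∀ u v → u ≢ v → (adj G u v ≡ true ⇔ NearC (blk u) (blk v)))

InP : ℕ → Graph → Set
InP l G = ∃ λ i → l ≤ i × (IsFatPath i G ⊎ IsFatCycle i G)

module Submission where

-- A fat path or fat cycle on at least l blocks contains an induced P_l: take one vertex per block.
-- Conversely, grow an induced path P on k ≥ max(3m, m + 4) vertices as long as possible.  In a claw-free,
-- B_{1,m}-free graph a vertex off P sees on P nothing, exactly one end, both ends, or exactly the existing
-- positions j - 1, j, j + 1: every other neighbourhood gives a claw, or a B_{1,m} whose tail of m vertices
-- runs along P on one side of the pattern, and 3m ≤ k leaves room on one of the two sides.  A vertex seeing
-- one end extends P, and so, by connectivity, does a vertex seeing nothing.  Once P cannot grow, every vertex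
-- lies in the block of a position of P or, if it sees both ends, in one extra block that closes a cycle, and
-- the same two obstructions make vertices adjacent exactly when their blocks are equal or consecutive.

open import Defs
open import Data.Bool using (Bool; true; false; _∧_; _∨_; not; if_then_else_)
import Data.Bool.Properties as Boolₚ
open import Data.Empty using (⊥; ⊥-elim)
open import Data.Fin using (Fin; toℕ; fromℕ<) renaming (zero to fz; suc to fs)
import Data.Fin.Properties as Finₚ
open import Data.Nat using (ℕ; zero; suc; _+_; _*_; _∸_; _≤_; _<_; _⊔_; z≤n; s≤s; _≡ᵇ_)
open import Data.Nat.Properties
open import Data.Nat.Tactic.RingSolver using (solve-∀)
open import Data.Product using (Σ; _×_; _,_; ∃; proj₁; proj₂)
open import Data.Sum using (_⊎_; inj₁; inj₂; [_,_]′)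
open import Data.Vec using (Vec; []; _∷_; lookup; tabulate)
open import Data.Vec.Properties using (lookup∘tabulate)
open import Function.Bundles using (_⇔_; mk⇔; Equivalence)
open import Function.Definitions using (Surjective)
open import Relation.Binary using (tri<; tri≈; tri>)
open import Relation.Binary.PropositionalEquality
  using (_≡_; _≢_; refl; sym; trans; cong; cong₂; subst; subst₂; module ≡-Reasoning)
open import Relation.Nullary using (¬_; yes; no; Dec)
open import Relation.Nullary.Decidable using (⌊_⌋; dec-true; dec-false; decidable-stable; _→-dec_; _×-dec_)

suc<⇒< : ∀ {i j} → suc i < j → i < j
suc<⇒< = <-trans (n<1+n _)

true≢false : true ≢ false
true≢false ()

pathAdj : ℕ → ℕ → Bool
pathAdj i j = (j ≡ᵇ suc i) ∨ (i ≡ᵇ suc j)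

-- Defs.NearP a b and Defs.NearC a b unfold to Near and NearCycle k applied to toℕ a and toℕ b.
Near : ℕ → ℕ → Set
Near i j = i ≡ j ⊎ suc i ≡ j ⊎ i ≡ suc j

Near-sym : ∀ {i j} → Near i j → Near j i
Near-sym (inj₁ e) = inj₁ (sym e)
Near-sym (inj₂ (inj₁ e)) = inj₂ (inj₂ (sym e))
Near-sym (inj₂ (inj₂ e)) = inj₂ (inj₁ (sym e))

near-or-far : ∀ i j → Near i j ⊎ suc i < j ⊎ suc j < i
near-or-far i j with <-cmp i j
... | tri≈ _ e _ = inj₁ (inj₁ e)
... | tri< i<j _ _ with m≤n⇒m<n∨m≡n i<j
...   | inj₁ far = inj₂ (inj₁ far)
...   | inj₂ e = inj₁ (inj₂ (inj₁ e))
near-or-far i j | tri> _ _ j<i with m≤n⇒m<n∨m≡n j<i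
...   | inj₁ far = inj₂ (inj₂ far)
...   | inj₂ e = inj₁ (inj₂ (inj₂ (sym e)))

pathAdj-sym : ∀ i j → pathAdj i j ≡ pathAdj j i
pathAdj-sym i j = Boolₚ.∨-comm (j ≡ᵇ suc i) (i ≡ᵇ suc j)

pathAdj-suc : ∀ i → pathAdj i (suc i) ≡ true
pathAdj-suc i rewrite dec-true (i ≟ i) refl = refl

pathAdj-pred : ∀ i → pathAdj (suc i) i ≡ true
pathAdj-pred i = trans (pathAdj-sym (suc i) i) (pathAdj-suc i)

pathAdj-far : ∀ {i j} → suc i < j → pathAdj i j ≡ false
pathAdj-far {i} {j} i+1<j
  rewrite dec-false (j ≟ suc i) (λ e → <-irrefl (sym e) i+1<j)
        | dec-false (i ≟ suc j) (λ e → <-asym (<-trans (n<1+n i) i+1<j) (subst (j <_) (sym e) (n<1+n j)))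
  = refl

pathAdj-far˘ : ∀ {i j} → suc j < i → pathAdj i j ≡ false
pathAdj-far˘ {i} {j} far = trans (pathAdj-sym i j) (pathAdj-far far)

pathAdj-irrefl : ∀ i → pathAdj i i ≡ false
pathAdj-irrefl i
  rewrite dec-false (i ≟ suc i) (λ e → <-irrefl e (n<1+n i)) = refl

pathAdj⇒Near : ∀ {i j} → pathAdj i j ≡ true → Near i j
pathAdj⇒Near {i} {j} e with j ≟ suc i | i ≟ suc j
... | yes j≡1+i | _ = inj₂ (inj₁ (sym j≡1+i))
... | no _ | yes i≡1+j = inj₂ (inj₂ i≡1+j)
... | no j≢1+i | no i≢1+j =
  ⊥-elim (true≢false (trans (sym e) (cong₂ _∨_ (dec-false (j ≟ suc i) j≢1+i) (dec-false (i ≟ suc j) i≢1+j))))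

Near⇒pathAdj : ∀ {i j} → i ≢ j → Near i j → pathAdj i j ≡ true
Near⇒pathAdj i≢j (inj₁ e) = ⊥-elim (i≢j e)
Near⇒pathAdj {i} _ (inj₂ (inj₁ refl)) = pathAdj-suc i
Near⇒pathAdj {j = j} _ (inj₂ (inj₂ refl)) = pathAdj-pred j

NearCycle : ℕ → ℕ → ℕ → Set
NearCycle l i j = Near i j ⊎ (i ≡ 0 × j ≡ l) ⊎ (i ≡ l × j ≡ 0)

NearCycle-sym : ∀ {l i j} → NearCycle l i j → NearCycle l j i
NearCycle-sym (inj₁ near) = inj₁ (Near-sym near)
NearCycle-sym (inj₂ (inj₁ (i≡0 , j≡l))) = inj₂ (inj₂ (j≡l , i≡0))
NearCycle-sym (inj₂ (inj₂ (i≡l , j≡0))) = inj₂ (inj₁ (j≡0 , i≡l))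

NearCycle⇒Near : ∀ {l i j} → i < l → j < l → NearCycle l i j → Near i j
NearCycle⇒Near _ _ (inj₁ near) = near
NearCycle⇒Near _ j<l (inj₂ (inj₁ (_ , refl))) = ⊥-elim (<-irrefl refl j<l)
NearCycle⇒Near i<l _ (inj₂ (inj₂ (refl , _))) = ⊥-elim (<-irrefl refl i<l)

pathAdj-unique : ∀ {i j} (b : Bool) → i ≢ j →
  (suc i ≡ j → b ≡ true) → (i ≡ suc j → b ≡ true) →
  (suc i < j → b ≡ false) → (suc j < i → b ≡ false) → b ≡ pathAdj i j
pathAdj-unique {i} {j} b i≢j up down above below with near-or-far i j
... | inj₁ (inj₁ e) = ⊥-elim (i≢j e)
... | inj₁ (inj₂ (inj₁ e)) = trans (up e) (sym (Near⇒pathAdj i≢j (inj₂ (inj₁ e))))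
... | inj₁ (inj₂ (inj₂ e)) = trans (down e) (sym (Near⇒pathAdj i≢j (inj₂ (inj₂ e))))
... | inj₂ (inj₁ far) = trans (above far) (sym (pathAdj-far far))
... | inj₂ (inj₂ far) = trans (below far) (sym (pathAdj-far˘ far))

pathAdj-⇔ : ∀ {b i j} → b ≡ pathAdj i j → i ≢ j → b ≡ true ⇔ Near i j
pathAdj-⇔ b≡ i≢j = mk⇔ (λ e → pathAdj⇒Near (trans (sym b≡) e)) (λ near → trans b≡ (Near⇒pathAdj i≢j near))

≤-from-sum : ∀ {a b c d} → a + b ≡ c + d → b ≤ d → c ≤ a
≤-from-sum {a} {b} {c} e b≤d = +-cancelʳ-≤ b c a (subst (c + b ≤_) (sym e) (+-monoʳ-≤ c b≤d))

<-from-sum : ∀ {a b c d} → a + b ≡ c + d → b < d → c < a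
<-from-sum {a} {b} e b<d =
  ≤-from-sum (trans (+-suc a b) (cong suc e)) b<d

-- Position i counted from the far end of 0, …, k - 1; junk for i ≥ k.
mirror : ℕ → ℕ → ℕ
mirror k i = k ∸ suc i

mirror-+ : ∀ {k i} → i < k → mirror k i + suc i ≡ k
mirror-+ = m∸n+n≡m

mirror-unique : ∀ {k i j} → j + suc i ≡ k → mirror k j ≡ i
mirror-unique {i = i} {j} refl = begin
  j + suc i ∸ suc j   ≡⟨ cong (_∸ suc j) (trans (+-suc j i) (cong suc (+-comm j i))) ⟩
  i + j ∸ j           ≡⟨ m+n∸n≡m i j ⟩
  i                   ∎
  where open ≡-Reasoning

mirror-< : ∀ {k i} → i < k → mirror k i < k
mirror-< {suc k} {i} _ = s≤s (m∸n≤m k i)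

mirror-+˘ : ∀ {k i} → i < k → i + suc (mirror k i) ≡ k
mirror-+˘ {k} {i} i<k = trans (+-suc i _) (trans (cong suc (+-comm i _)) (trans (sym (+-suc _ i)) (mirror-+ i<k)))

mirror-suc : ∀ {k i} → suc i < k → mirror k i ≡ suc (mirror k (suc i))
mirror-suc = +-∸-assoc 1

mirror-injective : ∀ {k i j} → i < k → j < k → mirror k i ≡ mirror k j → i ≡ j
mirror-injective {k} {i} {j} i<k j<k e =
  suc-injective (+-cancelˡ-≡ (mirror k i) _ _
    (trans (mirror-+ i<k) (trans (sym (mirror-+ j<k)) (cong (_+ suc j) (sym e)))))

mirror-antitone : ∀ {k i j} → j < k → suc i < j → suc (mirror k j) < mirror k i
mirror-antitone {k} {i} {j} j<k far =
  <-from-sum (trans (mirror-+ i<k) (trans (sym (mirror-+ j<k)) (+-suc (mirror k j) j))) far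
  where
    i<k : i < k
    i<k = <-trans (<-trans (n<1+n i) far) j<k

-- Room for a tail of length m below a pattern that leaves no room above it, as 3m ≤ k.

room-below : ∀ {m k lo} → 3 * m ≤ k → k ≤ lo + (m + m) → m ≤ lo
room-below {m} {k} {lo} 3m≤k k≤ = +-cancelʳ-≤ (m + m) m lo
  (subst (_≤ lo + (m + m)) (cong (λ z → m + (m + z)) (+-identityʳ m)) (≤-trans 3m≤k k≤))

room-below₂ : ∀ {m k lo} → 1 ≤ m → 3 * m ≤ k → k < suc (suc lo) + m → m ≤ lo
room-below₂ {m} {k} {lo} 1≤m 3m≤k k< = room-below 3m≤k (begin
  k                 ≤⟨ ≤-pred k< ⟩
  suc (lo + m)      ≡⟨ sym (+-suc lo m) ⟩
  lo + suc m        ≤⟨ +-monoʳ-≤ lo (+-monoˡ-≤ m 1≤m) ⟩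
  lo + (m + m)      ∎)
  where open ≤-Reasoning

room-below₃ : ∀ {m k lo} → 1 ≤ lo → 3 * m ≤ k → k < suc (suc (suc lo)) + m → m ≤ lo
room-below₃ {m} {k} {lo} 1≤lo 3m≤k k< with m ≤? 1
... | yes m≤1 = ≤-trans m≤1 1≤lo
... | no m≰1 = room-below 3m≤k (begin
  k                   ≤⟨ ≤-pred k< ⟩
  suc (suc (lo + m))  ≡⟨ sym (trans (+-suc lo (suc m)) (cong suc (+-suc lo m))) ⟩
  lo + suc (suc m)    ≤⟨ +-monoʳ-≤ lo (+-monoˡ-≤ m (≰⇒> m≰1)) ⟩
  lo + (m + m)        ∎)
  where open ≤-Reasoning

room-between : ∀ {m k i j} → 3 * m ≤ k → k < suc j + m → j < suc (suc i) + m → m ≤ suc i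
room-between {m} {k} {i} {j} 3m≤k k< j< = room-below 3m≤k (begin
  k                 ≤⟨ ≤-pred k< ⟩
  j + m             ≤⟨ +-monoˡ-≤ m (≤-pred j<) ⟩
  suc i + m + m     ≡⟨ +-assoc (suc i) m m ⟩
  suc i + (m + m)   ∎)
  where open ≤-Reasoning

room-above : ∀ {m k} d x a → x + (d + a) ≡ k → m ≤ a → (d + x) + m ≤ k
room-above {m} {k} d x a e m≤a = begin
  (d + x) + m   ≤⟨ +-monoʳ-≤ (d + x) m≤a ⟩
  (d + x) + a   ≡⟨ cong (_+ a) (+-comm d x) ⟩
  (x + d) + a   ≡⟨ +-assoc x d a ⟩
  x + (d + a)   ≡⟨ e ⟩
  k             ∎
  where open ≤-Reasoning

∧-off-diagonal : ∀ {k} (x y : Fin k) (b : Bool) → (x ≡ y → b ≡ false) → not ⌊ x Finₚ.≟ y ⌋ ∧ b ≡ b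
∧-off-diagonal x y b diag with x Finₚ.≟ y
... | yes x≡y = sym (diag x≡y)
... | no _ = refl

module GraphTheory (G : Graph) where

  V : Set
  V = Fin (n G)

  infix 5 _~_
  _~_ : V → V → Bool
  u ~ v = adj G u v

  ~-sym : ∀ u v → u ~ v ≡ v ~ u
  ~-sym = adj-sym G

  ~-symᵗ : ∀ {u v} → u ~ v ≡ true → v ~ u ≡ true
  ~-symᵗ {u} {v} e = trans (~-sym v u) e

  ~-symᶠ : ∀ {u v} → u ~ v ≡ false → v ~ u ≡ false
  ~-symᶠ {u} {v} e = trans (~-sym v u) e

  ~⇒≢ : ∀ {u v} → u ~ v ≡ true → u ≢ v
  ~⇒≢ {u} e refl = true≢false (trans (sym e) (irrefl G u))

  ~-separates : ∀ {u v w} → u ~ w ≡ true → v ~ w ≡ false → u ≢ v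
  ~-separates e₁ e₂ refl = true≢false (trans (sym e₁) e₂)

  inducedK13 : (c x y z : V) → c ~ x ≡ true → c ~ y ≡ true → c ~ z ≡ true →
    x ~ y ≡ false → x ~ z ≡ false → y ~ z ≡ false →
    x ≢ y → x ≢ z → y ≢ z → InducedSub K13 G
  inducedK13 c x y z cx cy cz xy xz yz x≢y x≢z y≢z = f , injective , adjacency
    where
      f : Fin 4 → V
      f fz = c
      f (fs fz) = x
      f (fs (fs fz)) = y
      f (fs (fs (fs fz))) = z
      injective : ∀ {i j} → f i ≡ f j → i ≡ j
      injective {fz} {fz} e = refl
      injective {fz} {fs fz} e = ⊥-elim (~⇒≢ cx e)
      injective {fz} {fs (fs fz)} e = ⊥-elim (~⇒≢ cy e)
      injective {fz} {fs (fs (fs fz))} e = ⊥-elim (~⇒≢ cz e)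
      injective {fs fz} {fz} e = ⊥-elim (~⇒≢ cx (sym e))
      injective {fs fz} {fs fz} e = refl
      injective {fs fz} {fs (fs fz)} e = ⊥-elim (x≢y e)
      injective {fs fz} {fs (fs (fs fz))} e = ⊥-elim (x≢z e)
      injective {fs (fs fz)} {fz} e = ⊥-elim (~⇒≢ cy (sym e))
      injective {fs (fs fz)} {fs fz} e = ⊥-elim (x≢y (sym e))
      injective {fs (fs fz)} {fs (fs fz)} e = refl
      injective {fs (fs fz)} {fs (fs (fs fz))} e = ⊥-elim (y≢z e)
      injective {fs (fs (fs fz))} {fz} e = ⊥-elim (~⇒≢ cz (sym e))
      injective {fs (fs (fs fz))} {fs fz} e = ⊥-elim (x≢z (sym e))
      injective {fs (fs (fs fz))} {fs (fs fz)} e = ⊥-elim (y≢z (sym e))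
      injective {fs (fs (fs fz))} {fs (fs (fs fz))} e = refl
      adjacency : ∀ u v → f u ~ f v ≡ adj K13 u v
      adjacency fz fz = irrefl G c
      adjacency fz (fs fz) = cx
      adjacency fz (fs (fs fz)) = cy
      adjacency fz (fs (fs (fs fz))) = cz
      adjacency (fs fz) fz = ~-symᵗ cx
      adjacency (fs fz) (fs fz) = irrefl G x
      adjacency (fs fz) (fs (fs fz)) = xy
      adjacency (fs fz) (fs (fs (fs fz))) = xz
      adjacency (fs (fs fz)) fz = ~-symᵗ cy
      adjacency (fs (fs fz)) (fs fz) = ~-symᶠ xy
      adjacency (fs (fs fz)) (fs (fs fz)) = irrefl G y
      adjacency (fs (fs fz)) (fs (fs (fs fz))) = yz
      adjacency (fs (fs (fs fz))) fz = ~-symᵗ cz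
      adjacency (fs (fs (fs fz))) (fs fz) = ~-symᶠ xz
      adjacency (fs (fs (fs fz))) (fs (fs fz)) = ~-symᶠ yz
      adjacency (fs (fs (fs fz))) (fs (fs (fs fz))) = irrefl G z

  -- q 0 — q 1 — ⋯ — q (k - 1); the values q i for i ≥ k are irrelevant.
  record InducedPath (k : ℕ) (q : ℕ → V) : Set where
    field
      injective : ∀ {i j} → i < k → j < k → q i ≡ q j → i ≡ j
      adj-next : ∀ {i} → suc i < k → q i ~ q (suc i) ≡ true
      nonadj-far : ∀ {i j} → j < k → suc i < j → q i ~ q j ≡ false

    adj-prev : ∀ {i} → suc i < k → q (suc i) ~ q i ≡ true
    adj-prev i+1<k = ~-symᵗ (adj-next i+1<k)

    nonadj-far˘ : ∀ {i j} → j < k → suc i < j → q j ~ q i ≡ false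
    nonadj-far˘ j<k far = ~-symᶠ (nonadj-far j<k far)

    distinct : ∀ {i j} → i < k → j < k → i ≢ j → q i ≢ q j
    distinct i<k j<k i≢j e = i≢j (injective i<k j<k e)

    adjacency : ∀ {i j} → i < k → j < k → q i ~ q j ≡ pathAdj i j
    adjacency {i} {j} i<k j<k with i ≟ j
    ... | yes refl = trans (irrefl G (q i)) (sym (pathAdj-irrefl i))
    ... | no i≢j = pathAdj-unique _ i≢j (λ { refl → adj-next j<k }) (λ { refl → adj-prev i<k })
                    (nonadj-far j<k) (nonadj-far˘ i<k)

  inducedB1 : (m : ℕ) (a b c d : V) (r : ℕ → V) → InducedPath m r →
    a ~ b ≡ true → a ~ c ≡ true → b ~ c ≡ true → a ~ d ≡ true → d ~ b ≡ false → d ~ c ≡ false →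
    b ~ r 0 ≡ true → (∀ t → suc t < m → b ~ r (suc t) ≡ false) →
    (∀ t → t < m → a ~ r t ≡ false) → (∀ t → t < m → c ~ r t ≡ false) →
    (∀ t → t < m → d ~ r t ≡ false) → InducedSub (B1 m) G
  inducedB1 m a b c d r R ab ac bc ad db dc br₀ br ar cr dr = f , injective , adjacency
    where
      open InducedPath R renaming (injective to r-injective; adjacency to r-adjacency)
      f : Fin (4 + m) → V
      f fz = a
      f (fs fz) = b
      f (fs (fs fz)) = c
      f (fs (fs (fs fz))) = d
      f (fs (fs (fs (fs t)))) = r (toℕ t)
      t<m : (t : Fin m) → toℕ t < m
      t<m = Finₚ.toℕ<n
      a≢b = ~⇒≢ ab
      a≢c = ~⇒≢ ac
      a≢d = ~⇒≢ ad
      b≢c = ~⇒≢ bc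
      b≢d : b ≢ d
      b≢d = ~-separates bc dc
      c≢d : c ≢ d
      c≢d = ~-separates (~-symᵗ bc) db
      a≢r : ∀ t → a ≢ r (toℕ t)
      a≢r t = ~-separates ac (~-symᶠ (cr _ (t<m t)))
      b≢r : ∀ t → b ≢ r (toℕ t)
      b≢r t = ~-separates (~-symᵗ ab) (~-symᶠ (ar _ (t<m t)))
      c≢r : ∀ t → c ≢ r (toℕ t)
      c≢r t = ~-separates (~-symᵗ ac) (~-symᶠ (ar _ (t<m t)))
      d≢r : ∀ t → d ≢ r (toℕ t)
      d≢r t = ~-separates (~-symᵗ ad) (~-symᶠ (ar _ (t<m t)))
      injective : ∀ {i j} → f i ≡ f j → i ≡ j
      injective {fz} {fz} e = refl
      injective {fz} {fs fz} e = ⊥-elim (a≢b e)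
      injective {fz} {fs (fs fz)} e = ⊥-elim (a≢c e)
      injective {fz} {fs (fs (fs fz))} e = ⊥-elim (a≢d e)
      injective {fz} {fs (fs (fs (fs t)))} e = ⊥-elim (a≢r t e)
      injective {fs fz} {fz} e = ⊥-elim (a≢b (sym e))
      injective {fs fz} {fs fz} e = refl
      injective {fs fz} {fs (fs fz)} e = ⊥-elim (b≢c e)
      injective {fs fz} {fs (fs (fs fz))} e = ⊥-elim (b≢d e)
      injective {fs fz} {fs (fs (fs (fs t)))} e = ⊥-elim (b≢r t e)
      injective {fs (fs fz)} {fz} e = ⊥-elim (a≢c (sym e))
      injective {fs (fs fz)} {fs fz} e = ⊥-elim (b≢c (sym e))
      injective {fs (fs fz)} {fs (fs fz)} e = refl
      injective {fs (fs fz)} {fs (fs (fs fz))} e = ⊥-elim (c≢d e)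
      injective {fs (fs fz)} {fs (fs (fs (fs t)))} e = ⊥-elim (c≢r t e)
      injective {fs (fs (fs fz))} {fz} e = ⊥-elim (a≢d (sym e))
      injective {fs (fs (fs fz))} {fs fz} e = ⊥-elim (b≢d (sym e))
      injective {fs (fs (fs fz))} {fs (fs fz)} e = ⊥-elim (c≢d (sym e))
      injective {fs (fs (fs fz))} {fs (fs (fs fz))} e = refl
      injective {fs (fs (fs fz))} {fs (fs (fs (fs t)))} e = ⊥-elim (d≢r t e)
      injective {fs (fs (fs (fs t)))} {fz} e = ⊥-elim (a≢r t (sym e))
      injective {fs (fs (fs (fs t)))} {fs fz} e = ⊥-elim (b≢r t (sym e))
      injective {fs (fs (fs (fs t)))} {fs (fs fz)} e = ⊥-elim (c≢r t (sym e))
      injective {fs (fs (fs (fs t)))} {fs (fs (fs fz))} e = ⊥-elim (d≢r t (sym e))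
      injective {fs (fs (fs (fs t)))} {fs (fs (fs (fs t')))} e =
        cong (λ s → fs (fs (fs (fs s)))) (Finₚ.toℕ-injective (r-injective (t<m t) (t<m t') e))
      adjacency : ∀ u v → f u ~ f v ≡ adj (B1 m) u v
      adjacency fz fz = irrefl G a
      adjacency fz (fs fz) = ab
      adjacency fz (fs (fs fz)) = ac
      adjacency fz (fs (fs (fs fz))) = ad
      adjacency fz (fs (fs (fs (fs t)))) = ar _ (t<m t)
      adjacency (fs fz) fz = ~-symᵗ ab
      adjacency (fs fz) (fs fz) = irrefl G b
      adjacency (fs fz) (fs (fs fz)) = bc
      adjacency (fs fz) (fs (fs (fs fz))) = ~-symᶠ db
      adjacency (fs fz) (fs (fs (fs (fs fz)))) = br₀
      adjacency (fs fz) (fs (fs (fs (fs (fs t))))) = br _ (s≤s (Finₚ.toℕ<n t))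
      adjacency (fs (fs fz)) fz = ~-symᵗ ac
      adjacency (fs (fs fz)) (fs fz) = ~-symᵗ bc
      adjacency (fs (fs fz)) (fs (fs fz)) = irrefl G c
      adjacency (fs (fs fz)) (fs (fs (fs fz))) = ~-symᶠ dc
      adjacency (fs (fs fz)) (fs (fs (fs (fs t)))) = cr _ (t<m t)
      adjacency (fs (fs (fs fz))) fz = ~-symᵗ ad
      adjacency (fs (fs (fs fz))) (fs fz) = db
      adjacency (fs (fs (fs fz))) (fs (fs fz)) = dc
      adjacency (fs (fs (fs fz))) (fs (fs (fs fz))) = irrefl G d
      adjacency (fs (fs (fs fz))) (fs (fs (fs (fs t)))) = dr _ (t<m t)
      adjacency (fs (fs (fs (fs t)))) fz = ~-symᶠ (ar _ (t<m t))
      adjacency (fs (fs (fs (fs fz)))) (fs fz) = ~-symᵗ br₀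
      adjacency (fs (fs (fs (fs (fs t))))) (fs fz) = ~-symᶠ (br _ (s≤s (Finₚ.toℕ<n t)))
      adjacency (fs (fs (fs (fs t)))) (fs (fs fz)) = ~-symᶠ (cr _ (t<m t))
      adjacency (fs (fs (fs (fs t)))) (fs (fs (fs fz))) = ~-symᶠ (dr _ (t<m t))
      adjacency (fs (fs (fs (fs t)))) (fs (fs (fs (fs t')))) =
        trans (r-adjacency (t<m t) (t<m t'))
          (sym (∧-off-diagonal (fs (fs (fs (fs t)))) (fs (fs (fs (fs t')))) _ λ { refl → pathAdj-irrefl (toℕ t) }))

  reverse : ∀ {k q} → InducedPath k q → InducedPath k (λ i → q (mirror k i))
  reverse {k} {q} P = record { injective = injective′ ; adj-next = adj-next′ ; nonadj-far = nonadj-far′ }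
    where
      open InducedPath P
      injective′ : ∀ {i j} → i < k → j < k → q (mirror k i) ≡ q (mirror k j) → i ≡ j
      injective′ i<k j<k e = mirror-injective i<k j<k (injective (mirror-< i<k) (mirror-< j<k) e)
      adj-next′ : ∀ {i} → suc i < k → q (mirror k i) ~ q (mirror k (suc i)) ≡ true
      adj-next′ {i} i+1<k rewrite mirror-suc {k} {i} i+1<k =
        adj-prev (subst (_< k) (mirror-suc i+1<k) (mirror-< (<-trans (n<1+n i) i+1<k)))
      nonadj-far′ : ∀ {i j} → j < k → suc i < j → q (mirror k i) ~ q (mirror k j) ≡ false
      nonadj-far′ {i} j<k far =
        nonadj-far˘ (mirror-< (<-trans (<-trans (n<1+n i) far) j<k)) (mirror-antitone j<k far)

  _[_≔_] : (ℕ → V) → ℕ → V → ℕ → V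
  (q [ j ≔ u ]) i = if i ≡ᵇ j then u else q i

  update-hit : ∀ q j u → (q [ j ≔ u ]) j ≡ u
  update-hit q j u rewrite dec-true (j ≟ j) refl = refl

  update-miss : ∀ q j u {i} → i ≢ j → (q [ j ≔ u ]) i ≡ q i
  update-miss q j u {i} i≢j rewrite dec-false (i ≟ j) i≢j = refl

  update-path : ∀ {k} (q : ℕ → V) (j : ℕ) (u : V) →
    (∀ {i i'} → i < k → i' < k → i ≢ j → i' ≢ j → q i ≡ q i' → i ≡ i') →
    (∀ {i} → suc i < k → i ≢ j → suc i ≢ j → q i ~ q (suc i) ≡ true) →
    (∀ {i i'} → i' < k → suc i < i' → i ≢ j → i' ≢ j → q i ~ q i' ≡ false) →
    (∀ {i} → i < k → i ≢ j → q i ≢ u) →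
    (∀ {i} → i < k → i ≢ j → q i ~ u ≡ pathAdj i j) →
    InducedPath k (q [ j ≔ u ])
  update-path {k} q j u q-inj q-next q-far q≢u u-adj =
    record { injective = injective ; adj-next = adj-next ; nonadj-far = nonadj-far }
    where
      hit = update-hit q j u
      miss = update-miss q j u
      injective : ∀ {i i'} → i < k → i' < k → (q [ j ≔ u ]) i ≡ (q [ j ≔ u ]) i' → i ≡ i'
      injective {i} {i'} i<k i'<k e with i ≟ j | i' ≟ j
      ... | yes refl | yes refl = refl
      ... | yes refl | no i'≢j = ⊥-elim (q≢u i'<k i'≢j (trans (sym (miss i'≢j)) (trans (sym e) hit)))
      ... | no i≢j | yes refl = ⊥-elim (q≢u i<k i≢j (trans (sym (miss i≢j)) (trans e hit)))
      ... | no i≢j | no i'≢j = q-inj i<k i'<k i≢j i'≢j (trans (sym (miss i≢j)) (trans e (miss i'≢j)))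
      adj-next : ∀ {i} → suc i < k → (q [ j ≔ u ]) i ~ (q [ j ≔ u ]) (suc i) ≡ true
      adj-next {i} i+1<k with i ≟ j | suc i ≟ j
      ... | yes refl | _ rewrite hit | miss {suc i} (λ ()) =
            trans (~-sym u (q (suc i))) (trans (u-adj i+1<k (λ ())) (pathAdj-pred i))
      ... | no i≢j | yes refl rewrite hit | miss i≢j = trans (u-adj (<-trans (n<1+n i) i+1<k) i≢j) (pathAdj-suc i)
      ... | no i≢j | no i+1≢j rewrite miss i≢j | miss i+1≢j = q-next i+1<k i≢j i+1≢j
      nonadj-far : ∀ {i i'} → i' < k → suc i < i' → (q [ j ≔ u ]) i ~ (q [ j ≔ u ]) i' ≡ false
      nonadj-far {i} {i'} i'<k far with i ≟ j | i' ≟ j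
      ... | yes refl | yes refl = ⊥-elim (<-irrefl refl (<-trans (n<1+n i) far))
      ... | yes refl | no i'≢j rewrite hit | miss i'≢j =
            trans (~-sym u (q i')) (trans (u-adj i'<k i'≢j) (pathAdj-far˘ far))
      ... | no i≢j | yes refl rewrite hit | miss i≢j =
            trans (u-adj (<-trans (<-trans (n<1+n i) far) i'<k) i≢j) (pathAdj-far far)
      ... | no i≢j | no i'≢j rewrite miss i≢j | miss i'≢j = q-far i'<k far i≢j i'≢j

  replace : ∀ {k q} → InducedPath k q → (j : ℕ) (u : V) →
    (∀ {i} → i < k → q i ≢ u) → (∀ {i} → i < k → i ≢ j → q i ~ u ≡ pathAdj i j) →
    InducedPath k (q [ j ≔ u ])
  replace P j u q≢u u-adj = update-path _ j u (λ i<k i'<k _ _ → injective i<k i'<k)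
    (λ i+1<k _ _ → adj-next i+1<k) (λ i'<k far _ _ → nonadj-far i'<k far) (λ i<k _ → q≢u i<k) u-adj
    where open InducedPath P

  append : ∀ {j q} → InducedPath (suc j) q → (u : V) → (∀ {i} → i < suc j → q i ≢ u) →
    q j ~ u ≡ true → (∀ i → i < j → q i ~ u ≡ false) → InducedPath (suc (suc j)) (q [ suc j ≔ u ])
  append {j} {q} P u q≢u last others = update-path q (suc j) u
    (λ i<k i'<k i≢ i'≢ → injective (below i<k i≢) (below i'<k i'≢))
    (λ i+1<k _ i+1≢ → adj-next (below i+1<k i+1≢)) (λ i'<k far _ i'≢ → nonadj-far (below i'<k i'≢) far)
    (λ i<k i≢ → q≢u (below i<k i≢)) u-adj
    where
      open InducedPath P
      below : ∀ {i} → i < suc (suc j) → i ≢ suc j → i < suc j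
      below (s≤s i≤) i≢ = ≤∧≢⇒< i≤ i≢
      u-adj : ∀ {i} → i < suc (suc j) → i ≢ suc j → q i ~ u ≡ pathAdj i (suc j)
      u-adj {i} i<k i≢ with m≤n⇒m<n∨m≡n (below i<k i≢)
      ... | inj₂ refl = trans last (sym (pathAdj-suc j))
      ... | inj₁ far = trans (others i (≤-pred far)) (sym (pathAdj-far far))

  -- The extended path is traversed backwards: q j, …, q 0, u.
  prepend : ∀ {j q} → InducedPath (suc j) q → (u : V) → (∀ {i} → i < suc j → q i ≢ u) →
    q 0 ~ u ≡ true → (∀ i → 1 ≤ i → i < suc j → q i ~ u ≡ false) →
    InducedPath (suc (suc j)) ((λ i → q (mirror (suc j) i)) [ suc j ≔ u ])
  prepend {j} {q} P u q≢u first others = append (reverse P) u (λ i<k → q≢u (mirror-< i<k)) last others′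
    where
      last : q (mirror (suc j) j) ~ u ≡ true
      last = subst (λ i → q i ~ u ≡ true) (sym (mirror-unique (+-comm j 1))) first
      others′ : ∀ i → i < j → q (mirror (suc j) i) ~ u ≡ false
      others′ i i<j = others _ (m<n⇒0<n∸m i<j) (mirror-< (<-trans i<j (n<1+n j)))

  prefix : ∀ {k q} → InducedPath (suc k) q → InducedPath k q
  prefix P = record
    { injective = λ i<k j<k → injective (<-trans i<k (n<1+n _)) (<-trans j<k (n<1+n _))
    ; adj-next = λ i+1<k → adj-next (<-trans i+1<k (n<1+n _))
    ; nonadj-far = λ j<k → nonadj-far (<-trans j<k (n<1+n _)) }
    where open InducedPath P

  copy⇒path : ∀ {k} → InducedSub (Path (suc k)) G → Σ (ℕ → V) (InducedPath (suc k))
  copy⇒path {k} (f , f-injective , f-adj) = q , record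
    { injective = λ i<k j<k e →
        trans (sym (Finₚ.toℕ-fromℕ< i<k))
          (trans (cong toℕ (f-injective (trans (sym (q-at i<k)) (trans e (q-at j<k))))) (Finₚ.toℕ-fromℕ< j<k))
    ; adj-next = λ {i} i+1<k → trans (q-adj (<-trans (n<1+n i) i+1<k) i+1<k) (pathAdj-suc i)
    ; nonadj-far = λ {i} j<k far → trans (q-adj (<-trans (<-trans (n<1+n i) far) j<k) j<k) (pathAdj-far far) }
    where
      q : ℕ → V
      q i with i <? suc k
      ... | yes i<k = f (fromℕ< i<k)
      ... | no _ = f fz
      q-at : ∀ {i} (i<k : i < suc k) → q i ≡ f (fromℕ< i<k)
      q-at {i} i<k with i <? suc k
      ... | yes _ = refl
      ... | no i≮k = ⊥-elim (i≮k i<k)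
      q-adj : ∀ {i j} (i<k : i < suc k) (j<k : j < suc k) → q i ~ q j ≡ pathAdj i j
      q-adj i<k j<k rewrite q-at i<k | q-at j<k =
        trans (f-adj (fromℕ< i<k) (fromℕ< j<k))
          (trans (∧-off-diagonal (fromℕ< i<k) (fromℕ< j<k) _ λ e → subst (λ x → pathAdj (toℕ (fromℕ< i<k)) (toℕ x) ≡ false) e (pathAdj-irrefl (toℕ (fromℕ< i<k))))
            (cong₂ pathAdj (Finₚ.toℕ-fromℕ< i<k) (Finₚ.toℕ-fromℕ< j<k)))

  length≤order : ∀ {k q} → InducedPath k q → k ≤ n G
  length≤order {k} {q} P with n G <? k
  ... | no n≮k = ≮⇒≥ n≮k
  ... | yes n<k with Finₚ.pigeonhole n<k (λ i → q (toℕ i))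
  ...   | i , j , i<j , e =
          ⊥-elim (<-irrefl (InducedPath.injective P (Finₚ.toℕ<n i) (Finₚ.toℕ<n j) e) i<j)

  window-< : ∀ {k l s t} → s + l ≤ k → t < l → t + s < k
  window-< {k} {l} {s} room t<l = <-≤-trans (+-monoˡ-< s t<l) (subst (_≤ k) (+-comm s l) room)

  window : ∀ {k q} → InducedPath k q → ∀ {l} s → s + l ≤ k → InducedPath l (λ t → q (t + s))
  window P s room = record
    { injective = λ i<l j<l e → +-cancelʳ-≡ s _ _ (injective (window-< room i<l) (window-< room j<l) e)
    ; adj-next = λ i+1<l → adj-next (window-< room i+1<l)
    ; nonadj-far = λ j<l far → nonadj-far (window-< room j<l) (+-monoˡ-< s far) }
    where open InducedPath P

  Misses : V → (ℕ → V) → ℕ → ℕ → Set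
  Misses y q s e = ∀ i → s ≤ i → i < e → y ~ q i ≡ false

  Misses-narrow : ∀ {y q s e s′ e′} → s ≤ s′ → e′ ≤ e → Misses y q s e → Misses y q s′ e′
  Misses-narrow s≤s′ e′≤e gap i s′≤i i<e′ = gap i (≤-trans s≤s′ s′≤i) (<-≤-trans i<e′ e′≤e)

  Misses-window : ∀ {y q s l} → Misses y q s (s + l) → ∀ t → t < l → y ~ q (t + s) ≡ false
  Misses-window {s = s} gap t t<l = gap (t + s) (m≤n+m s t) (subst (t + s <_) (+-comm _ s) (+-monoˡ-< s t<l))

  Misses-window-tail : ∀ {y q s l} → Misses y q (suc s) (s + l) → ∀ t → suc t < l → y ~ q (suc t + s) ≡ false
  Misses-window-tail {s = s} gap t t+1<l =
    gap (suc t + s) (s≤s (m≤n+m s t)) (subst (suc t + s <_) (+-comm _ s) (+-monoˡ-< s t+1<l))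

  Misses-mirror : ∀ {y q k s₀ e₀ s e} → Misses y q s₀ e₀ → s₀ + e ≡ k → e₀ + s ≡ k →
    Misses y (λ i → q (mirror k i)) s e
  Misses-mirror {k = k} {s₀} {s = s} {e} gap s₀+e≡k e₀+s≡k j s≤j j<e =
    gap (mirror k j) (≤-from-sum (trans (mirror-+ j<k) (sym s₀+e≡k)) j<e)
                     (<-from-sum (trans e₀+s≡k (sym (mirror-+ j<k))) (s≤s s≤j))
    where
      j<k : j < k
      j<k = <-≤-trans j<e (subst (e ≤_) s₀+e≡k (m≤n+m e s₀))

-- Local obstructions: a vertex x off an induced path P whose neighbourhood on P has one of the shapes
-- below yields a claw or a B_{1,m}.  Symbolic names spell that neighbourhood along P: h a neighbour, o a
-- non-neighbour, - at least one position in between; ↑ (↓): the tail of the B_{1,m} runs up (down) along P.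
module Obstructions (G : Graph) (m : ℕ) (1≤m : 1 ≤ m)
  (K13-free : ¬ InducedSub K13 G) (B1-free : ¬ InducedSub (B1 m) G)
  {k : ℕ} {q : ℕ → Fin (n G)} (P : GraphTheory.InducedPath G k q)
  (x : Fin (n G)) (x∉P : ∀ {i} → i < k → q i ≢ x) where

  open GraphTheory G
  open InducedPath P

  N : ℕ → Bool
  N i = x ~ q i

  Gap : ℕ → ℕ → Set
  Gap = Misses x q

  N˘ : ∀ {i b} → N i ≡ b → q i ~ x ≡ b
  N˘ {i} e = trans (~-sym (q i) x) e

  x≢ : ∀ {i} → i < k → x ≢ q i
  x≢ i<k e = x∉P i<k (sym e)

  room⇒< : ∀ {s} → s + m ≤ k → s < k
  room⇒< {s} room = <-≤-trans (subst (s <_) (+-comm m s) (m<n+m s 1≤m)) room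

  tail-below : ∀ {p s} → suc p < s → s + m ≤ k → ∀ t → t < m → q p ~ q (t + s) ≡ false
  tail-below {s = s} p<s room t t<m = nonadj-far (window-< room t<m) (≤-trans p<s (m≤n+m s t))

  tail-above : ∀ {p s} → s + m < p → p < k → ∀ t → t < m → q p ~ q (t + s) ≡ false
  tail-above {s = s} room<p p<k t t<m =
    nonadj-far˘ p<k (≤-<-trans (subst (suc t + s ≤_) (+-comm m s) (+-monoˡ-≤ s t<m)) room<p)

  tail-next : ∀ {b} → suc b + m ≤ k → ∀ t → suc t < m → q b ~ q (suc t + suc b) ≡ false
  tail-next {b} room t t+1<m = nonadj-far (window-< room t+1<m) (s≤s (m≤n+m (suc b) t))

  ¬isolated-hit : ∀ i → suc (suc i) < k → N i ≡ false → N (suc i) ≡ true → N (suc (suc i)) ≡ false → ⊥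
  ¬isolated-hit i i+2<k o h o′ = K13-free (inducedK13 (q (suc i)) x (q i) (q (suc (suc i)))
    (N˘ h) (adj-prev (suc<⇒< i+2<k)) (adj-next i+2<k) o o′ (nonadj-far i+2<k (n<1+n _))
    (x≢ (suc<⇒< (suc<⇒< i+2<k))) (x≢ i+2<k) (distinct (suc<⇒< (suc<⇒< i+2<k)) i+2<k λ ()))

  ¬spread-hits : ∀ a b c → suc a < b → suc b < c → c < k → N a ≡ true → N b ≡ true → N c ≡ true → ⊥
  ¬spread-hits a b c a<b b<c c<k ha hb hc = K13-free (inducedK13 x (q a) (q b) (q c) ha hb hc
    (nonadj-far b<k a<b) (nonadj-far c<k a<c) (nonadj-far c<k b<c)
    (distinct a<k b<k (λ { refl → <-irrefl refl (suc<⇒< a<b) }))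
    (distinct a<k c<k (λ { refl → <-irrefl refl (suc<⇒< a<c) }))
    (distinct b<k c<k (λ { refl → <-irrefl refl (suc<⇒< b<c) })))
    where
      b<k = <-trans (suc<⇒< b<c) c<k
      a<c = <-trans a<b (suc<⇒< b<c)
      a<k = <-trans (suc<⇒< a<b) b<k

  ¬ohh↑ : ∀ p → suc (suc (suc p)) + m ≤ k → N p ≡ false → N (suc p) ≡ true → N (suc (suc p)) ≡ true →
    Gap (suc (suc (suc p))) (suc (suc (suc p)) + m) → ⊥
  ¬ohh↑ p room o h h′ gap = B1-free (inducedB1 m (q (suc p)) (q (suc (suc p))) x (q p) _ (window P _ room)
    (adj-next p+2<k) (N˘ h) (N˘ h′) (adj-prev (suc<⇒< p+2<k)) (nonadj-far p+2<k (n<1+n _)) (N˘ o)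
    (adj-next (room⇒< room)) (tail-next room) (tail-below (n<1+n _) room) (Misses-window gap)
    (tail-below (s≤s (n≤1+n _)) room))
    where
      p+2<k = suc<⇒< (room⇒< room)

  ¬h-hh↑ : ∀ p s → suc p < s → suc (suc s) + m ≤ k → N p ≡ true → N s ≡ true → N (suc s) ≡ true →
    Gap (suc (suc s)) (suc (suc s) + m) → ⊥
  ¬h-hh↑ p s p<s room h h′ h″ gap = B1-free (inducedB1 m x (q (suc s)) (q s) (q p) _ (window P _ room)
    h″ h′ (adj-prev s+1<k) h (nonadj-far s+1<k (<-trans p<s (n<1+n s))) (nonadj-far (suc<⇒< s+1<k) p<s)
    (adj-next (room⇒< room)) (tail-next room) (Misses-window gap) (tail-below (n<1+n _) room)
    (tail-below (<-trans p<s (<-trans (n<1+n s) (n<1+n _))) room))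
    where
      s+1<k = suc<⇒< (room⇒< room)

  ¬ohh-h↑ : ∀ p h → suc (suc (suc (suc p))) ≤ h → h + m ≤ k →
    N p ≡ false → N (suc p) ≡ true → N (suc (suc p)) ≡ true → N h ≡ true → Gap (suc h) (h + m) → ⊥
  ¬ohh-h↑ p h p+4≤h room o h₁ h₂ hh gap = B1-free (inducedB1 m (q (suc p)) x (q (suc (suc p))) (q p) _
    (window P h room) (N˘ h₁) (adj-next p+2<k) h₂ (adj-prev (suc<⇒< p+2<k)) (N˘ o) (nonadj-far p+2<k (n<1+n _))
    hh (Misses-window-tail gap) (tail-below (≤-trans (s≤s (s≤s (n≤1+n _))) p+4≤h) room)
    (tail-below p+4≤h room) (tail-below (≤-trans (s≤s (n≤1+n _)) (≤-trans (s≤s (s≤s (n≤1+n _))) p+4≤h)) room))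
    where
      p+2<k : suc (suc p) < k
      p+2<k = <-trans (≤-trans (s≤s (s≤s (s≤s (n≤1+n _)))) p+4≤h) (room⇒< room)

  ¬hho-h↑ : ∀ i h → suc (suc (suc (suc i))) ≤ h → h + m ≤ k →
    N i ≡ true → N (suc i) ≡ true → N (suc (suc i)) ≡ false → N h ≡ true → Gap (suc h) (h + m) → ⊥
  ¬hho-h↑ i h i+4≤h room h₀ h₁ o hh gap = B1-free (inducedB1 m (q (suc i)) x (q i) (q (suc (suc i))) _
    (window P h room) (N˘ h₁) (adj-prev (suc<⇒< i+2<k)) h₀ (adj-next i+2<k) (N˘ o) (nonadj-far˘ i+2<k (n<1+n _))
    hh (Misses-window-tail gap) (tail-below (≤-trans (s≤s (s≤s (n≤1+n _))) i+4≤h) room)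
    (tail-below (≤-trans (s≤s (n≤1+n _)) (≤-trans (s≤s (s≤s (n≤1+n _))) i+4≤h)) room)
    (tail-below i+4≤h room))
    where
      i+2<k : suc (suc i) < k
      i+2<k = <-trans (≤-trans (s≤s (s≤s (s≤s (n≤1+n _)))) i+4≤h) (room⇒< room)

  ¬h-hho : ∀ p s → p + m < s → suc (suc s) < k → N p ≡ true → Gap (suc p) (p + m) →
    N s ≡ true → N (suc s) ≡ true → N (suc (suc s)) ≡ false → ⊥
  ¬h-hho p s room<s s+2<k hp gap h₀ h₁ o = B1-free (inducedB1 m (q (suc s)) x (q s) (q (suc (suc s))) _
    (window P p room) (N˘ h₁) (adj-prev s+1<k) h₀ (adj-next s+2<k) (N˘ o) (nonadj-far˘ s+2<k (n<1+n _))
    hp (Misses-window-tail gap) (tail-above (<-trans room<s (n<1+n s)) s+1<k) (tail-above room<s s<k)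
    (tail-above (<-trans room<s (<-trans (n<1+n s) (n<1+n _))) s+2<k))
    where
      s+1<k = suc<⇒< s+2<k
      s<k = suc<⇒< s+1<k
      room : p + m ≤ k
      room = <⇒≤ (<-trans room<s s<k)

  ¬hh-h : ∀ i j → suc (suc i) + m < j → j < k → N i ≡ true → N (suc i) ≡ true →
    Gap (suc (suc i)) (suc (suc i) + m) → N j ≡ true → ⊥
  ¬hh-h i j room<j j<k h₀ h₁ gap hj = B1-free (inducedB1 m x (q (suc i)) (q i) (q j) _ (window P _ room)
    h₁ h₀ (adj-prev i+1<k) hj (nonadj-far˘ j<k (≤-<-trans (m≤m+n _ m) room<j))
    (nonadj-far˘ j<k (≤-<-trans (n≤1+n _) (≤-<-trans (m≤m+n _ m) room<j)))
    (adj-next (room⇒< room)) (tail-next room) (Misses-window gap) (tail-below (n<1+n _) room)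
    (tail-above room<j j<k))
    where
      room : suc (suc i) + m ≤ k
      room = <⇒≤ (<-trans room<j j<k)
      i+1<k = suc<⇒< (room⇒< room)

  ¬pendant-at-triangle : ∀ v → 2 + m ≤ k → N 0 ≡ true → N 1 ≡ false → Gap 2 (2 + m) → x ~ v ≡ false →
    v ~ q 0 ≡ true → v ~ q 1 ≡ true → Misses v q 2 k → ⊥
  ¬pendant-at-triangle v room h o gap xv v₀ v₁ v-gap = B1-free (inducedB1 m (q 0) (q 1) v x _ (window P 2 room)
    (adj-next 1<k) (~-symᵗ v₀) (~-symᵗ v₁) (N˘ h) o xv (adj-next (room⇒< room)) (tail-next room)
    (tail-below (s≤s (s≤s z≤n)) room) (Misses-window (Misses-narrow ≤-refl room v-gap)) (Misses-window gap))
    where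
      1<k = suc<⇒< (room⇒< room)

-- Forbidden neighbourhoods anywhere on a long path: each shape is excluded by an obstruction on P or,
-- when there is no room for a tail above it, on the reversed path.
module Shapes (G : Graph) (m : ℕ) (1≤m : 1 ≤ m)
  (K13-free : ¬ InducedSub K13 G) (B1-free : ¬ InducedSub (B1 m) G)
  {k : ℕ} {q : ℕ → Fin (n G)} (P : GraphTheory.InducedPath G k q)
  (x : Fin (n G)) (x∉P : ∀ {i} → i < k → q i ≢ x)
  (3m≤k : 3 * m ≤ k) (m+4≤k : m + 4 ≤ k) where

  open GraphTheory G
  open Obstructions G m 1≤m K13-free B1-free P x x∉P public
  module R = Obstructions G m 1≤m K13-free B1-free (reverse P) x (λ i<k → x∉P (mirror-< i<k))

  N-mirror : ∀ {i j b} → j + suc i ≡ k → N i ≡ b → R.N j ≡ b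
  N-mirror e h = trans (cong (λ z → x ~ q z) (mirror-unique e)) h

  mirror-step : ∀ {i j} → j + suc (suc i) ≡ k → suc j + suc i ≡ k
  mirror-step {i} {j} e = trans (sym (+-suc j (suc i))) e

  +-swap : ∀ d a p → a + (d + p) ≡ p + (d + a)
  +-swap = solve-∀

  ¬inner-edge : ∀ a → suc (suc (suc a)) < k → Gap 0 (suc a) → N (suc a) ≡ true → N (suc (suc a)) ≡ true →
    Gap (suc (suc (suc a))) k → ⊥
  ¬inner-edge a a+3<k below h h′ above with suc (suc (suc a)) + m ≤? k
  ... | yes room = ¬ohh↑ a room (below a z≤n (n<1+n a)) h h′ (Misses-narrow ≤-refl room above)
  ... | no no-room = R.¬ohh↑ p room′ (N-mirror e (above _ ≤-refl a+3<k)) (N-mirror e₁ h′) (N-mirror e₂ h) (Misses-narrow ≤-refl room′ (Misses-mirror below refl (trans (+-swap 3 (suc a) p) e)))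
    where
      p = mirror k (suc (suc (suc a)))
      e : p + suc (suc (suc (suc a))) ≡ k
      e = mirror-+ a+3<k
      e₁ : suc p + suc (suc (suc a)) ≡ k
      e₁ = mirror-step {j = p} e
      e₂ : suc (suc p) + suc (suc a) ≡ k
      e₂ = mirror-step {j = suc p} e₁
      room′ : suc (suc (suc p)) + m ≤ k
      room′ = room-above 3 p (suc a) e (room-below₂ 1≤m 3m≤k (≰⇒> no-room))

  ¬four-run : ∀ a → suc (suc (suc a)) < k → Gap 0 a → N a ≡ true → N (suc a) ≡ true → N (suc (suc a)) ≡ true →
    N (suc (suc (suc a))) ≡ true → Gap (suc (suc (suc (suc a)))) k → ⊥
  ¬four-run zero _ _ h₀ _ h₂ h₃ above = ¬h-hh↑ 0 2 (s≤s (s≤s z≤n)) room h₀ h₂ h₃ (Misses-narrow ≤-refl room above)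
    where
      room : 4 + m ≤ k
      room = subst (_≤ k) (+-comm m 4) m+4≤k
  ¬four-run (suc a) a+4<k below h₀ h₁ h₂ h₃ above with suc (suc (suc (suc a))) + m ≤? k
  ... | yes room = ¬ohh-h↑ a _ ≤-refl room (below a z≤n (n<1+n a)) h₀ h₁ h₃ (Misses-narrow ≤-refl room above)
  ... | no no-room = R.¬h-hh↑ p (suc (suc p)) ≤-refl room′ (N-mirror e h₃) (N-mirror e₂ h₁) (N-mirror e₃ h₀) (Misses-narrow ≤-refl room′ (Misses-mirror below refl (trans (+-swap 4 (suc a) p) e)))
    where
      p = mirror k (suc (suc (suc (suc a))))
      e : p + suc (suc (suc (suc (suc a)))) ≡ k
      e = mirror-+ a+4<k
      e₂ : suc (suc p) + suc (suc (suc a)) ≡ k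
      e₂ = mirror-step {j = suc p} (mirror-step {j = p} e)
      e₃ : suc (suc (suc p)) + suc (suc a) ≡ k
      e₃ = mirror-step {j = suc (suc p)} e₂
      room′ : suc (suc (suc (suc p))) + m ≤ k
      room′ = room-above 4 p (suc a) e (room-below₃ (s≤s z≤n) 3m≤k (≰⇒> no-room))

  ¬end-edge : ∀ b → 2 ≤ b → suc b < k → N 0 ≡ true → Gap 1 b → N b ≡ true → N (suc b) ≡ true →
    Gap (suc (suc b)) k → ⊥
  ¬end-edge b 2≤b b+1<k h₀ middle hb hb′ above with m≤n⇒m<n∨m≡n b+1<k
  ... | inj₂ e = R.¬hh-h 0 (suc b) room<j (subst (suc b <_) e (n<1+n _)) (N-mirror e hb′) (N-mirror e hb)
          (Misses-narrow ≤-refl (<⇒≤ room<j) (Misses-mirror middle e (trans (+-comm b 2) e)))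
          (N-mirror (trans (+-comm (suc b) 1) e) h₀)
    where
      room<j : suc (suc m) < suc b
      room<j = ≤-pred (subst (_≤ suc (suc b)) (+-comm m 4) (subst (m + 4 ≤_) (sym e) m+4≤k))
  ¬end-edge (suc b) 2≤b b+1<k h₀ middle hb hb′ above | inj₁ b+2<k with suc (suc (suc b)) + m ≤? k
  ... | yes room = ¬h-hh↑ 0 (suc b) 2≤b room h₀ hb hb′ (Misses-narrow ≤-refl room above)
  ... | no no-room = ¬h-hho 0 (suc b) (s≤s m≤b) b+2<k h₀ (Misses-narrow ≤-refl (≤-trans m≤b (n≤1+n b)) middle)
          hb hb′ (above _ ≤-refl b+2<k)
    where
      m≤b : m ≤ b
      m≤b = room-below₃ (≤-pred 2≤b) 3m≤k (≰⇒> no-room)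

  ¬h-ohh↓ : ∀ i j → suc (suc i) ≤ j → suc (suc j) < k → m ≤ suc i → Gap 0 i → N i ≡ true →
    N j ≡ false → N (suc j) ≡ true → N (suc (suc j)) ≡ true → ⊥
  ¬h-ohh↓ i j i+2≤j j+2<k m≤i+1 below hi o h₁ h₂ =
    R.¬hho-h↑ i′ h′ i′+4≤h′ room′ (N-mirror eⱼ h₂) (N-mirror e₁ h₁) (N-mirror e₂ o) (N-mirror eᵢ hi)
      (Misses-narrow ≤-refl room′ (Misses-mirror below refl (mirror-+˘ i<k)))
    where
      i<k : i < k
      i<k = <-trans (≤-trans (n≤1+n _) (≤-trans i+2≤j (n≤1+n _))) (suc<⇒< j+2<k)
      h′ = mirror k i
      eᵢ : h′ + suc i ≡ k
      eᵢ = mirror-+ i<k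
      i′ = mirror k (suc (suc j))
      eⱼ : i′ + suc (suc (suc j)) ≡ k
      eⱼ = mirror-+ j+2<k
      e₁ : suc i′ + suc (suc j) ≡ k
      e₁ = mirror-step {j = i′} eⱼ
      e₂ : suc (suc i′) + suc j ≡ k
      e₂ = mirror-step {j = suc i′} e₁
      room′ : h′ + m ≤ k
      room′ = ≤-trans (+-monoʳ-≤ h′ m≤i+1) (≤-reflexive eᵢ)
      shuffle : ∀ a b → suc (suc (suc (suc a))) + suc b ≡ a + suc (suc (suc (suc (suc b))))
      shuffle = solve-∀
      i′+4≤h′ : suc (suc (suc (suc i′))) ≤ h′
      i′+4≤h′ = +-cancelʳ-≤ (suc i) _ h′ (begin
        suc (suc (suc (suc i′))) + suc i        ≡⟨ shuffle i′ i ⟩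
        i′ + suc (suc (suc (suc (suc i))))      ≤⟨ +-monoʳ-≤ i′ (s≤s (s≤s (s≤s i+2≤j))) ⟩
        i′ + suc (suc (suc j))                  ≡⟨ trans eⱼ (sym eᵢ) ⟩
        h′ + suc i                              ∎)
        where open ≤-Reasoning

  ¬two-edges : ∀ i j → suc (suc (suc i)) ≤ j → suc j < k → Gap 0 i → N i ≡ true → N (suc i) ≡ true →
    Gap (suc (suc i)) j → N j ≡ true → N (suc j) ≡ true → Gap (suc (suc j)) k → ⊥
  ¬two-edges i zero () _ _ _ _ _ _ _ _
  ¬two-edges i (suc j) i+3≤j+1 j+2<k below hi hi′ middle hj hj′ above with suc (suc j) + m ≤? k
  ... | yes room = ¬hho-h↑ i (suc (suc j)) (s≤s i+3≤j+1) room hi hi′ (middle _ ≤-refl i+3≤j+1) hj′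
                     (Misses-narrow ≤-refl room above)
  ... | no no-room with suc (suc i) + m ≤? suc j
  ...   | yes gap-room = ¬hh-h i (suc (suc j)) (s≤s gap-room) j+2<k hi hi′ (Misses-narrow ≤-refl gap-room middle) hj′
  ...   | no no-gap-room = ¬h-ohh↓ i j (≤-pred i+3≤j+1) j+2<k (room-between 3m≤k (≰⇒> no-room) (≰⇒> no-gap-room))
                             below hi (middle j (≤-pred i+3≤j+1) (n<1+n j)) hj hj′

module Classification (G : Graph) (m : ℕ) (1≤m : 1 ≤ m)
  (K13-free : ¬ InducedSub K13 G) (B1-free : ¬ InducedSub (B1 m) G)
  {k : ℕ} {q : ℕ → Fin (n G)} (P : GraphTheory.InducedPath G k q)
  (x : Fin (n G)) (x∉P : ∀ {i} → i < k → q i ≢ x)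
  (3m≤k : 3 * m ≤ k) (m+4≤k : m + 4 ≤ k) where

  open GraphTheory G
  open Shapes G m 1≤m K13-free B1-free P x x∉P 3m≤k m+4≤k public
  module Reflected = Shapes G m 1≤m K13-free B1-free (reverse P) x (λ i<k → x∉P (mirror-< i<k)) 3m≤k m+4≤k

  record Block (j : ℕ) : Set where
    field
      hit : N j ≡ true
      hit-below : ∀ {p} → suc p ≡ j → N p ≡ true
      hit-above : suc j < k → N (suc j) ≡ true
      gap-below : ∀ i → suc i < j → N i ≡ false
      gap-above : Gap (suc (suc j)) k

    N≡pathAdj : ∀ {i} → i < k → i ≢ j → N i ≡ pathAdj i j
    N≡pathAdj i<k i≢j = pathAdj-unique _ i≢j hit-below (λ { refl → hit-above i<k })
      (gap-below _) (λ far → gap-above _ far i<k)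

  data Attachment : Set where
    detached : Gap 0 k → Attachment
    at-start : N 0 ≡ true → Gap 1 k → Attachment
    at-end : ∀ j → suc j ≡ k → N j ≡ true → Gap 0 j → Attachment
    closing : ∀ j → suc j ≡ k → N 0 ≡ true → N j ≡ true → Gap 1 j → Attachment
    around : ∀ j → j < k → Block j → Attachment

  FirstHit : ℕ → Set
  FirstHit s = Σ ℕ λ c → s ≤ c × c < k × N c ≡ true × Gap s c

  Gap-extend : ∀ {s e} → N s ≡ false → Gap (suc s) e → Gap s e
  Gap-extend o gap i s≤i i<e with m≤n⇒m<n∨m≡n s≤i
  ... | inj₁ s<i = gap i s<i i<e
  ... | inj₂ refl = o

  first-hit : ∀ s → FirstHit s ⊎ Gap s k
  first-hit s = search k s (m≤m+n k s)
    where
      search : ∀ fuel s → k ≤ fuel + s → FirstHit s ⊎ Gap s k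
      search zero s k≤s = inj₂ (λ i s≤i i<k → ⊥-elim (<⇒≱ i<k (≤-trans k≤s s≤i)))
      search (suc fuel) s bound with s <? k
      ... | no s≮k = inj₂ (λ i s≤i i<k → ⊥-elim (s≮k (≤-<-trans s≤i i<k)))
      ... | yes s<k with N s in e
      ...   | true = inj₁ (s , ≤-refl , s<k , e , λ i s≤i i<s → ⊥-elim (<⇒≱ i<s s≤i))
      ...   | false with search fuel (suc s) (subst (k ≤_) (sym (+-suc fuel s)) bound)
      ...     | inj₁ (c , s<c , c<k , hc , gap) = inj₁ (c , ≤-trans (n≤1+n s) s<c , c<k , hc , Gap-extend e gap)
      ...     | inj₂ gap = inj₂ (Gap-extend e gap)

  ¬isolated-hit-after : ∀ s b → s ≤ b → suc (suc b) < k → N (suc b) ≡ true → Gap s (suc b) →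
    N (suc (suc b)) ≡ false → ⊥
  ¬isolated-hit-after s b s≤b b+2<k h gap o = ¬isolated-hit b b+2<k (gap b s≤b (n<1+n b)) h o

  ¬edge-end : ∀ a c → 1 ≤ a → suc (suc (suc a)) ≤ c → suc c ≡ k → Gap 0 a → N a ≡ true → N (suc a) ≡ true →
    Gap (suc (suc a)) c → N c ≡ true → ⊥
  ¬edge-end a c 1≤a a+3≤c e below ha ha′ middle hc =
    Reflected.¬end-edge b 2≤b b+1<k (N-mirror e hc) (Misses-mirror middle (trans (+-comm (suc (suc a)) b) eb) (trans (+-comm c 1) e))
      (N-mirror eb ha′) (N-mirror eb′ ha) (Misses-mirror below refl (trans (+-swap 2 a b) eb))
    where
      a+1<k : suc a < k
      a+1<k = <-trans (≤-trans (s≤s (s≤s (n≤1+n a))) a+3≤c) (subst (c <_) e (n<1+n c))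
      b = mirror k (suc a)
      eb : b + suc (suc a) ≡ k
      eb = mirror-+ a+1<k
      eb′ : suc b + suc a ≡ k
      eb′ = mirror-step {j = b} eb
      2≤b : 2 ≤ b
      2≤b = +-cancelʳ-≤ (suc (suc a)) 2 b (subst (suc (suc (suc (suc a))) ≤_) (trans e (sym eb)) (s≤s a+3≤c))
      b+1<k : suc b < k
      b+1<k = subst (suc b <_) eb′ (m<m+n (suc b) (s≤s z≤n))

  lone-hit : ∀ a → a < k → N a ≡ true → Gap 0 a → Gap (suc a) k → Attachment
  lone-hit zero _ h _ above = at-start h above
  lone-hit (suc a) a<k h below above with m≤n⇒m<n∨m≡n a<k
  ... | inj₂ e = at-end (suc a) e h below
  ... | inj₁ a+2<k = ⊥-elim (¬isolated-hit a a+2<k (below a z≤n (n<1+n a)) h (above _ ≤-refl a+2<k))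

  hit-then-gap : ∀ a b → suc a < b → b < k → N a ≡ true → N b ≡ true → Gap 0 a → Gap (suc a) b → Attachment
  hit-then-gap (suc a) b far b<k ha hb below middle =
    ⊥-elim (¬isolated-hit a (<-trans far b<k) (below a z≤n (n<1+n a)) ha (middle _ ≤-refl far))
  hit-then-gap zero zero () _ _ _ _ _
  hit-then-gap zero (suc b) far b+1<k h₀ hb _ middle with m≤n⇒m<n∨m≡n b+1<k
  ... | inj₂ e = closing (suc b) e h₀ hb middle
  ... | inj₁ b+2<k with first-hit (suc (suc b))
  ...   | inj₂ above = ⊥-elim (¬isolated-hit-after 1 b (≤-pred far) b+2<k hb middle (above _ ≤-refl b+2<k))
  ...   | inj₁ (c , b+2≤c , c<k , hc , gap) with m≤n⇒m<n∨m≡n b+2≤c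
  ...     | inj₁ b+2<c = ⊥-elim (¬isolated-hit-after 1 b (≤-pred far) b+2<k hb middle (gap _ ≤-refl b+2<c))
  ...     | inj₂ refl with first-hit (suc (suc (suc b)))
  ...       | inj₁ (d , c<d , d<k , hd , _) = ⊥-elim (¬spread-hits 0 (suc b) d far c<d d<k h₀ hb hd)
  ...       | inj₂ above = ⊥-elim (¬end-edge (suc b) far b+2<k h₀ middle hb hc above)

  last-edge : ∀ a → suc a < k → N a ≡ true → N (suc a) ≡ true → Gap 0 a → Gap (suc (suc a)) k → Attachment
  last-edge zero 1<k h₀ h₁ _ above = around 0 (suc<⇒< 1<k) record
    { hit = h₀ ; hit-below = λ () ; hit-above = λ _ → h₁ ; gap-below = λ _ () ; gap-above = above }
  last-edge (suc a) a+2<k ha ha′ below above with m≤n⇒m<n∨m≡n a+2<k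
  ... | inj₂ e = around (suc (suc a)) a+2<k record
    { hit = ha′ ; hit-below = λ { refl → ha } ; hit-above = λ a+3<k → ⊥-elim (<-irrefl e a+3<k)
    ; gap-below = λ i i+1<a+2 → below i z≤n (≤-pred i+1<a+2) ; gap-above = Misses-narrow (n≤1+n _) ≤-refl above }
  ... | inj₁ a+3<k = ⊥-elim (¬inner-edge a a+3<k below ha ha′ above)

  triple : ∀ a → suc (suc a) < k → N a ≡ true → N (suc a) ≡ true → N (suc (suc a)) ≡ true → Gap 0 a → Attachment
  triple a a+2<k h₀ h₁ h₂ below with first-hit (suc (suc (suc a)))
  ... | inj₂ above = around (suc a) (suc<⇒< a+2<k) record
    { hit = h₁ ; hit-below = λ { refl → h₀ } ; hit-above = λ _ → h₂
    ; gap-below = λ i i+1<a+1 → below i z≤n (≤-pred i+1<a+1) ; gap-above = above }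
  ... | inj₁ (d , a+3≤d , d<k , hd , _) with m≤n⇒m<n∨m≡n a+3≤d
  ...   | inj₁ a+3<d = ⊥-elim (¬spread-hits a (suc (suc a)) d (n<1+n (suc a)) a+3<d d<k h₀ h₂ hd)
  ...   | inj₂ refl with first-hit (suc (suc (suc (suc a))))
  ...     | inj₁ (e , d<e , e<k , he , _) = ⊥-elim (¬spread-hits a (suc (suc a)) e (n<1+n (suc a)) d<e e<k h₀ h₂ he)
  ...     | inj₂ above = ⊥-elim (¬four-run a d<k below h₀ h₁ h₂ hd above)

  ¬edge-then-inner-hit : ∀ a c → suc (suc a) < c → suc c < k → N a ≡ true → N (suc a) ≡ true → N c ≡ true →
    Gap 0 a → Gap (suc (suc a)) c → ⊥
  ¬edge-then-inner-hit a zero ()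
  ¬edge-then-inner-hit a (suc c) far c+2<k ha ha′ hc below middle with first-hit (suc (suc c))
  ... | inj₂ above = ¬isolated-hit-after (suc (suc a)) c (≤-pred far) c+2<k hc middle (above _ ≤-refl c+2<k)
  ... | inj₁ (d , c+2≤d , d<k , hd , gap) with m≤n⇒m<n∨m≡n c+2≤d
  ...   | inj₁ c+2<d = ¬isolated-hit-after (suc (suc a)) c (≤-pred far) c+2<k hc middle (gap _ ≤-refl c+2<d)
  ...   | inj₂ refl with first-hit (suc (suc (suc c)))
  ...     | inj₁ (e , d<e , e<k , he , _) = ¬spread-hits a (suc c) e (<-trans (n<1+n (suc a)) far) d<e e<k ha hc he
  ...     | inj₂ above = ¬two-edges a (suc c) far d<k below ha ha′ middle hc hd above

  ¬edge-then-hit : ∀ a c → suc (suc a) < c → c < k → N a ≡ true → N (suc a) ≡ true → N c ≡ true →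
    Gap 0 a → Gap (suc (suc a)) c → ⊥
  ¬edge-then-hit a c far c<k ha ha′ hc below middle with m≤n⇒m<n∨m≡n c<k
  ... | inj₁ c+1<k = ¬edge-then-inner-hit a c far c+1<k ha ha′ hc below middle
  ¬edge-then-hit zero c far c<k h₀ h₁ hc _ middle | inj₂ e =
    ¬hh-h 0 c room c<k h₀ h₁ (Misses-narrow ≤-refl (<⇒≤ room) middle) hc
    where
      room : suc (suc m) < c
      room = ≤-pred (subst (_≤ suc c) (+-comm m 4) (subst (m + 4 ≤_) (sym e) m+4≤k))
  ¬edge-then-hit (suc a) c far c<k ha ha′ hc below middle | inj₂ e = ¬edge-end (suc a) c (s≤s z≤n) far e below ha ha′ middle hc

  edge : ∀ a → suc a < k → N a ≡ true → N (suc a) ≡ true → Gap 0 a → Attachment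
  edge a a+1<k ha ha′ below with first-hit (suc (suc a))
  ... | inj₂ above = last-edge a a+1<k ha ha′ below above
  ... | inj₁ (c , a+2≤c , c<k , hc , middle) with m≤n⇒m<n∨m≡n a+2≤c
  ...   | inj₂ refl = triple a c<k ha ha′ hc below
  ...   | inj₁ far = ⊥-elim (¬edge-then-hit a c far c<k ha ha′ hc below middle)

  from-first-hit : ∀ a → a < k → N a ≡ true → Gap 0 a → Attachment
  from-first-hit a a<k ha below with first-hit (suc a)
  ... | inj₂ above = lone-hit a a<k ha below above
  ... | inj₁ (b , a<b , b<k , hb , middle) with m≤n⇒m<n∨m≡n a<b
  ...   | inj₂ refl = edge a b<k ha hb below
  ...   | inj₁ far = hit-then-gap a b far b<k ha hb below middle

  attachment : Attachment
  attachment with first-hit 0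
  ... | inj₂ none = detached none
  ... | inj₁ (a , _ , a<k , ha , below) = from-first-hit a a<k ha below

find-or-all : ∀ {n} (B C : Fin n → Set) → (∀ v → B v ⊎ C v) → Σ (Fin n) B ⊎ (∀ v → C v)
find-or-all {zero} B C dec = inj₂ (λ ())
find-or-all {suc n} B C dec with dec fz
... | inj₁ b = inj₁ (fz , b)
... | inj₂ c with find-or-all (λ v → B (fs v)) (λ v → C (fs v)) (λ v → dec (fs v))
...   | inj₁ (v , b) = inj₁ (fs v , b)
...   | inj₂ cs = inj₂ (λ { fz → c ; (fs v) → cs v })

module Growth (G : Graph) (m : ℕ) (1≤m : 1 ≤ m)
  (K13-free : ¬ InducedSub K13 G) (B1-free : ¬ InducedSub (B1 m) G)
  {k₂ : ℕ} {q : ℕ → Fin (n G)} (P : GraphTheory.InducedPath G (suc (suc k₂)) q)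
  (3m≤k : 3 * m ≤ suc (suc k₂)) (m+4≤k : m + 4 ≤ suc (suc k₂)) where

  open GraphTheory G
  open InducedPath P

  k : ℕ
  k = suc (suc k₂)

  last<k : suc k₂ < k
  last<k = n<1+n (suc k₂)

  Off : V → Set
  Off v = ∀ {i} → i < k → q i ≢ v

  module Attach (v : V) (v∉P : Off v) = Classification G m 1≤m K13-free B1-free P v v∉P 3m≤k m+4≤k
  open Attach using (Block)

  Longer : Set
  Longer = Σ (ℕ → V) (InducedPath (suc k))

  data Placed (v : V) : Set where
    on-path : ∀ j → j < k → q j ≡ v → Placed v
    in-block : (v∉P : Off v) → ∀ j → j < k → Block v v∉P j → Placed v
    closer : Off v → v ~ q 0 ≡ true → v ~ q (suc k₂) ≡ true → Misses v q 1 (suc k₂) → Placed v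

  Far : V → Set
  Far v = Misses v q 0 k

  on-path? : ∀ v → (Σ ℕ λ j → j < k × q j ≡ v) ⊎ Off v
  on-path? v with Finₚ.any? (λ (i : Fin k) → q (toℕ i) Finₚ.≟ v)
  ... | yes (i , e) = inj₁ (toℕ i , Finₚ.toℕ<n i , e)
  ... | no none = inj₂ (λ {i} i<k e → none (fromℕ< i<k , subst (λ j → q j ≡ v) (sym (Finₚ.toℕ-fromℕ< i<k)) e))

  classify : ∀ v → (Longer ⊎ (Off v × Far v)) ⊎ Placed v
  classify v with on-path? v
  ... | inj₁ (j , j<k , e) = inj₂ (on-path j j<k e)
  ... | inj₂ v∉P with Attach.attachment v v∉P
  ...   | Attach.detached gap = inj₁ (inj₂ (v∉P , gap))
  ...   | Attach.at-start h gap =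
          inj₁ (inj₁ (_ , prepend P v v∉P (~-symᵗ h) (λ i 1≤i i<k → ~-symᶠ (gap i 1≤i i<k))))
  ...   | Attach.at-end j refl h gap =
          inj₁ (inj₁ (_ , append P v v∉P (~-symᵗ h) (λ i i<j → ~-symᶠ (gap i z≤n i<j))))
  ...   | Attach.closing j refl h₀ h gap = inj₂ (closer v∉P h₀ h gap)
  ...   | Attach.around j j<k B = inj₂ (in-block v∉P j j<k B)

  placed⇒¬far : ∀ {v} → Placed v → ¬ Far v
  placed⇒¬far (on-path j j<k refl) far with m≤n⇒m<n∨m≡n j<k
  ... | inj₁ j+1<k = true≢false (trans (sym (adj-next j+1<k)) (far (suc j) z≤n j+1<k))
  ... | inj₂ refl = true≢false (trans (sym (adj-prev last<k)) (far k₂ z≤n (suc<⇒< last<k)))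
  placed⇒¬far (in-block v∉P j j<k B) far = true≢false (trans (sym (Block.hit B)) (far j z≤n j<k))
  placed⇒¬far (closer _ h₀ _ _) far = true≢false (trans (sym h₀) (far 0 z≤n (s≤s z≤n)))

  walk : ∀ {a b} → Reachable G a b → Placed a → Far b →
    Longer ⊎ Σ V λ u → Σ V λ w → Placed u × Off w × Far w × u ~ w ≡ true
  walk here placed far = ⊥-elim (placed⇒¬far placed far)
  walk (step {w = w} e rest) placed far with classify w
  ... | inj₁ (inj₁ longer) = inj₁ longer
  ... | inj₁ (inj₂ (w∉P , w-far)) = inj₂ (_ , w , placed , w∉P , w-far , e)
  ... | inj₂ placed′ = walk rest placed′ far

  swap-in : ∀ {u} (u∉P : Off u) j → Block u u∉P j → InducedPath k (q [ j ≔ u ])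
  swap-in {u} u∉P j B =
    replace P j u u∉P (λ {i} i<k i≢j → trans (~-sym (q i) u) (Block.N≡pathAdj u u∉P B i<k i≢j))

  ∉-swap : ∀ {y j z} → Off y → z ≢ y → ∀ {i} → i < k → (q [ j ≔ z ]) i ≢ y
  ∉-swap {y} {j} {z} y∉P z≢y {i} i<k with i ≟ j
  ... | yes refl = λ e → z≢y (trans (sym (update-hit q i z)) e)
  ... | no i≢j = λ e → y∉P i<k (trans (sym (update-miss q j z i≢j)) e)

  sees-other : ∀ j z {y t b} → t ≢ j → y ~ q t ≡ b → y ~ (q [ j ≔ z ]) t ≡ b
  sees-other j z {y} t≢j e = trans (cong (y ~_) (update-miss q j z t≢j)) e

  sees-swapped : ∀ j z {y b} → y ~ z ≡ b → y ~ (q [ j ≔ z ]) j ≡ b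
  sees-swapped j z {y} e = trans (cong (y ~_) (update-hit q j z)) e

  misses-swapped : ∀ j z {y s e} → (∀ t → s ≤ t → t < e → t ≢ j → y ~ q t ≡ false) →
    (s ≤ j → j < e → y ~ z ≡ false) → Misses y (q [ j ≔ z ]) s e
  misses-swapped j z gap at-j t s≤t t<e with t ≟ j
  ... | yes refl = sees-swapped t z (at-j s≤t t<e)
  ... | no t≢j = sees-other j z t≢j (gap t s≤t t<e t≢j)

  claw-at-inner-block : ∀ {u w} (u∉P : Off u) j → suc (suc j) < k → Block u u∉P (suc j) → Off w → Far w → u ~ w ≡ true → ⊥
  claw-at-inner-block {u} {w} u∉P j j+2<k B w∉P w-far uw = K13-free (inducedK13 u w (q j) (q (suc (suc j))) uw
    (Block.hit-below B refl) (Block.hit-above B j+2<k) (w-far j z≤n j<k) (w-far _ z≤n j+2<k)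
    (nonadj-far j+2<k (n<1+n _)) (λ e → w∉P j<k (sym e)) (λ e → w∉P j+2<k (sym e))
    (distinct j<k j+2<k (λ ())))
    where
      j<k = suc<⇒< (suc<⇒< j+2<k)

  extend-at-edge : ∀ u w → Placed u → Off w → Far w → u ~ w ≡ true → Longer
  extend-at-edge u w (on-path j j<k refl) w∉P w-far uw = ⊥-elim (true≢false (trans (sym uw) (~-symᶠ (w-far j z≤n j<k))))
  extend-at-edge u w (closer u∉P h₀ h gap) w∉P w-far uw =
    _ , append shifted w w∉shifted (trans (cong (_~ w) (update-hit q′ (suc k₂) u)) uw) others
    where
      q′ : ℕ → V
      q′ i = q (mirror (suc k₂) i)
      shifted : InducedPath (suc (suc k₂)) (q′ [ suc k₂ ≔ u ])
      shifted = prepend (prefix P) u (λ i<k → u∉P (<-trans i<k last<k)) (~-symᵗ h₀) (λ i 1≤i i<k → ~-symᶠ (gap i 1≤i i<k))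
      w∉shifted : ∀ {i} → i < suc (suc k₂) → (q′ [ suc k₂ ≔ u ]) i ≢ w
      w∉shifted {i} i<k with i ≟ suc k₂
      ... | yes refl = λ e → ~⇒≢ uw (trans (sym (update-hit q′ (suc k₂) u)) e)
      ... | no i≢ = λ e → w∉P (<-trans (mirror-< (≤∧≢⇒< (≤-pred i<k) i≢)) last<k)
                                (trans (sym (update-miss q′ (suc k₂) u i≢)) e)
      others : ∀ i → i < suc k₂ → (q′ [ suc k₂ ≔ u ]) i ~ w ≡ false
      others i i<k = trans (cong (_~ w) (update-miss q′ (suc k₂) u (λ e → <-irrefl e i<k)))
                       (~-symᶠ (w-far _ z≤n (<-trans (mirror-< i<k) last<k)))
  extend-at-edge u w (in-block u∉P zero j<k B) w∉P w-far uw =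
    _ , prepend (swap-in u∉P 0 B) w (∉-swap w∉P (~⇒≢ uw)) (trans (cong (_~ w) (update-hit q 0 u)) uw)
          (λ i 1≤i i<k → trans (cong (_~ w) (update-miss q 0 u (λ { refl → <-irrefl refl 1≤i })))
                           (~-symᶠ (w-far i z≤n i<k)))
  extend-at-edge u w (in-block u∉P (suc j) j<k B) w∉P w-far uw with m≤n⇒m<n∨m≡n j<k
  ... | inj₁ j+2<k = ⊥-elim (claw-at-inner-block u∉P j j+2<k B w∉P w-far uw)
  ... | inj₂ refl = _ , append (swap-in u∉P (suc k₂) B) w (∉-swap w∉P (~⇒≢ uw))
          (trans (cong (_~ w) (update-hit q (suc k₂) u)) uw)
          (λ i i<k → trans (cong (_~ w) (update-miss q (suc k₂) u (λ e → <-irrefl e i<k)))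
                       (~-symᶠ (w-far i z≤n (<-trans i<k last<k))))

  module Swapped {q′ : ℕ → V} (P′ : InducedPath k q′) (y : V) (y∉P′ : ∀ {i} → i < k → q′ i ≢ y) =
    Shapes G m 1≤m K13-free B1-free P′ y y∉P′ 3m≤k m+4≤k

  5≤k : 5 ≤ k
  5≤k = ≤-trans (+-monoˡ-≤ 4 1≤m) m+4≤k

  k≰4 : ∀ {x} → k ≤ x → x ≤ 4 → ⊥
  k≰4 k≤x x≤4 = <-irrefl refl (≤-trans 5≤k (≤-trans k≤x x≤4))

  ahead : ∀ d {i} → d + suc i ≤ i → ⊥
  ahead d {i} p = <-irrefl refl (≤-trans (m≤n+m (suc i) d) p)

  misses-beyond : ∀ {y f s} → k ≤ s → Misses y f s k
  misses-beyond k≤s t s≤t t<k = ⊥-elim (<⇒≱ t<k (≤-trans k≤s s≤t))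

  ¬nonadj-same-block : ∀ {u v} (u∉P : Off u) (v∉P : Off v) j → j < k → Block u u∉P j → Block v v∉P j →
    u ≢ v → u ~ v ≡ false → ⊥
  ¬nonadj-same-block {u} {v} u∉P v∉P j j<k Bu Bv u≢v uv with suc (suc j) <? k
  ... | yes j+2<k = K13-free (inducedK13 (q (suc j)) v u (q (suc (suc j)))
          (~-symᵗ (Block.hit-above Bv j+1<k)) (~-symᵗ (Block.hit-above Bu j+1<k)) (adj-next j+2<k)
          (~-symᶠ uv) (Block.gap-above Bv _ ≤-refl j+2<k) (Block.gap-above Bu _ ≤-refl j+2<k)
          (λ e → u≢v (sym e)) (λ e → v∉P j+2<k (sym e)) (λ e → u∉P j+2<k (sym e)))
    where
      j+1<k = suc<⇒< j+2<k
  ... | no j+2≮k = near-end j j<k Bu Bv (≮⇒≥ j+2≮k)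
    where
      near-end : ∀ j → j < k → Block u u∉P j → Block v v∉P j → k ≤ suc (suc j) → ⊥
      near-end zero _ _ _ k≤ = k≰4 k≤ (s≤s (s≤s z≤n))
      near-end (suc zero) _ _ _ k≤ = k≰4 k≤ (s≤s (s≤s (s≤s z≤n)))
      near-end (suc (suc j)) j+2<k Bu Bv _ = K13-free (inducedK13 (q (suc j)) v u (q j)
          (~-symᵗ (Block.hit-below Bv refl)) (~-symᵗ (Block.hit-below Bu refl)) (adj-prev j+1<k)
          (~-symᶠ uv) (Block.gap-below Bv _ ≤-refl) (Block.gap-below Bu _ ≤-refl)
          (λ e → u≢v (sym e)) (λ e → v∉P j<k′ (sym e)) (λ e → u∉P j<k′ (sym e)))
        where
          j+1<k = suc<⇒< j+2<k
          j<k′ = suc<⇒< j+1<k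

  ¬nonadj-next-block : ∀ {u v} (u∉P : Off u) (v∉P : Off v) i → suc i < k → Block u u∉P i → Block v v∉P (suc i) →
    u ≢ v → u ~ v ≡ false → ⊥
  ¬nonadj-next-block {u} {v} u∉P v∉P i i+1<k Bu Bv u≢v uv with suc (suc (suc i)) <? k
  ... | yes i+3<k = Swapped.¬inner-edge (swap-in u∉P i Bu) v (∉-swap v∉P u≢v) i i+3<k
          (misses-swapped i u (λ t _ t<i+1 t≢i → Block.gap-below Bv t (s≤s (≤∧≢⇒< (≤-pred t<i+1) t≢i))) (λ _ _ → ~-symᶠ uv))
          (sees-other i u (λ ()) (Block.hit Bv)) (sees-other i u (λ ()) (Block.hit-above Bv (suc<⇒< i+3<k)))
          (misses-swapped i u (λ t i+3≤t t<k _ → Block.gap-above Bv t i+3≤t t<k) (λ p _ → ⊥-elim (ahead 2 p)))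
  ... | no i+3≮k = near-end i i+1<k Bu Bv (≮⇒≥ i+3≮k)
    where
      near-end : ∀ i → suc i < k → Block u u∉P i → Block v v∉P (suc i) → k ≤ suc (suc (suc i)) → ⊥
      near-end zero _ _ _ k≤ = k≰4 k≤ (s≤s (s≤s (s≤s z≤n)))
      near-end (suc zero) _ _ _ k≤ = k≰4 k≤ (s≤s (s≤s (s≤s (s≤s z≤n))))
      near-end (suc (suc a)) a+3<k Bu Bv _ =
        Swapped.¬inner-edge (swap-in v∉P _ Bv) u (∉-swap u∉P (λ e → u≢v (sym e))) a a+3<k
          (misses-swapped (suc (suc (suc a))) v (λ t _ t<a+1 _ → Block.gap-below Bu t (s≤s t<a+1)) (λ _ p → ⊥-elim (ahead 2 p)))
          (sees-other (suc (suc (suc a))) v (λ ()) (Block.hit-below Bu refl))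
          (sees-other (suc (suc (suc a))) v (λ ()) (Block.hit Bu))
          (misses-swapped (suc (suc (suc a))) v (λ t a+3≤t t<k t≢ → Block.gap-above Bu t (≤∧≢⇒< a+3≤t (λ e → t≢ (sym e))) t<k) (λ _ _ → uv))

  ¬adj-blocks-two-apart : ∀ {u v} (u∉P : Off u) (v∉P : Off v) i → suc (suc i) < k →
    Block u u∉P i → Block v v∉P (suc (suc i)) → u ≢ v → u ~ v ≡ true → ⊥
  ¬adj-blocks-two-apart {u} {v} u∉P v∉P i i+2<k Bu Bv u≢v uv with suc (suc (suc i)) <? k
  ... | yes i+3<k = Swapped.¬four-run (swap-in u∉P i Bu) v (∉-swap v∉P u≢v) i i+3<k
          (misses-swapped i u (λ t _ t<i _ → Block.gap-below Bv t (≤-trans (s≤s t<i) (n≤1+n _)))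
            (λ _ i<i → ⊥-elim (<-irrefl refl i<i)))
          (sees-swapped i u (~-symᵗ uv)) (sees-other i u (λ ()) (Block.hit-below Bv refl))
          (sees-other i u (λ ()) (Block.hit Bv)) (sees-other i u (λ ()) (Block.hit-above Bv i+3<k))
          (misses-swapped i u (λ t i+4≤t t<k _ → Block.gap-above Bv t i+4≤t t<k) (λ p _ → ⊥-elim (ahead 3 p)))
  ... | no i+3≮k = near-end i i+2<k Bu Bv (≮⇒≥ i+3≮k)
    where
      near-end : ∀ i → suc (suc i) < k → Block u u∉P i → Block v v∉P (suc (suc i)) → k ≤ suc (suc (suc i)) → ⊥
      near-end zero _ _ _ k≤ = k≰4 k≤ (s≤s (s≤s (s≤s z≤n)))
      near-end (suc i) i+3<k Bu Bv k≤ =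
        Swapped.¬four-run (swap-in v∉P _ Bv) u (∉-swap u∉P (λ e → u≢v (sym e))) i i+3<k
          (misses-swapped j v (λ t _ t<i _ → Block.gap-below Bu t (s≤s t<i)) (λ _ p → ⊥-elim (ahead 3 p)))
          (sees-other j v (λ ()) (Block.hit-below Bu refl)) (sees-other j v (λ ()) (Block.hit Bu))
          (sees-other j v (λ ()) (Block.hit-above Bu (suc<⇒< i+3<k))) (sees-swapped j v uv) (misses-beyond k≤)
        where
          j = suc (suc (suc i))

  ¬adj-blocks-further : ∀ {u v} (u∉P : Off u) (v∉P : Off v) i j → j < k → suc (suc i) < j →
    Block u u∉P i → Block v v∉P j → u ≢ v → u ~ v ≡ true → ⊥
  ¬adj-blocks-further {u} {v} u∉P v∉P (suc i) j j<k i+3<j Bu Bv u≢v uv =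
    K13-free (inducedK13 u v (q i) (q (suc (suc i))) uv (Block.hit-below Bu refl) (Block.hit-above Bu i+2<k)
      (Block.gap-below Bv i (<-trans (n<1+n _) (<-trans (n<1+n _) i+3<j))) (Block.gap-below Bv _ i+3<j)
      (nonadj-far i+2<k (n<1+n _)) (λ e → v∉P i<k (sym e)) (λ e → v∉P i+2<k (sym e)) (distinct i<k i+2<k (λ ())))
    where
      i+2<k = <-trans (<-trans (n<1+n _) i+3<j) j<k
      i<k = suc<⇒< (suc<⇒< i+2<k)
  ¬adj-blocks-further {u} {v} u∉P v∉P zero (suc j) j+1<k 2<j+1 Bu Bv u≢v uv with suc (suc j) <? k
  ... | yes j+2<k = K13-free (inducedK13 v u (q j) (q (suc (suc j))) (~-symᵗ uv) (Block.hit-below Bv refl)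
          (Block.hit-above Bv j+2<k) (Block.gap-above Bu j (≤-pred 2<j+1) j<k) (Block.gap-above Bu _ (s≤s (s≤s z≤n)) j+2<k)
          (nonadj-far j+2<k (n<1+n _)) (λ e → u∉P j<k (sym e)) (λ e → u∉P j+2<k (sym e)) (distinct j<k j+2<k (λ ())))
    where
      j<k = suc<⇒< j+1<k
  ... | no j+2≮k = Swapped.¬end-edge (swap-in u∉P 0 Bu) v (∉-swap v∉P u≢v) j (≤-pred 2<j+1) j+1<k
          (sees-swapped 0 u (~-symᵗ uv))
          (misses-swapped 0 u (λ t _ t<j _ → Block.gap-below Bv t (s≤s t<j)) (λ ()))
          (sees-other 0 u (λ { refl → <⇒≱ 2<j+1 (s≤s z≤n) }) (Block.hit-below Bv refl))
          (sees-other 0 u (λ ()) (Block.hit Bv)) (misses-beyond (≮⇒≥ j+2≮k))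

  ¬adj-distant-blocks : ∀ {u v} (u∉P : Off u) (v∉P : Off v) i j → j < k → suc i < j →
    Block u u∉P i → Block v v∉P j → u ≢ v → u ~ v ≡ true → ⊥
  ¬adj-distant-blocks u∉P v∉P i j j<k i+1<j Bu Bv with m≤n⇒m<n∨m≡n i+1<j
  ... | inj₁ i+2<j = ¬adj-blocks-further u∉P v∉P i j j<k i+2<j Bu Bv
  ... | inj₂ refl = ¬adj-blocks-two-apart u∉P v∉P i j<k Bu Bv

  1≤k₂ : 1 ≤ k₂
  1≤k₂ = ≤-pred (≤-pred (≤-trans (s≤s (s≤s (s≤s z≤n))) 5≤k))

  2≤k₂ : 2 ≤ k₂
  2≤k₂ = ≤-pred (≤-pred (≤-trans (s≤s (s≤s (s≤s (s≤s z≤n)))) 5≤k))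

  room : 2 + m ≤ suc k₂
  room = ≤-pred (≤-trans (n≤1+n _) (subst (_≤ k) (+-comm m 4) m+4≤k))

  ¬nonadj-closer-first-block : ∀ {z v} (z∉P : Off z) (v∉P : Off v) → z ~ q 0 ≡ true → Misses z q 1 (suc k₂) →
    Block v v∉P 0 → z ~ v ≡ false → ⊥
  ¬nonadj-closer-first-block {z} {v} z∉P v∉P h₀ gap Bv zv =
    Attach.¬pendant-at-triangle z z∉P v (≤-trans room (n≤1+n _)) h₀ (gap 1 ≤-refl (s≤s 1≤k₂))
      (Misses-narrow (s≤s z≤n) room gap) zv (Block.hit Bv) (Block.hit-above Bv (s≤s (s≤s z≤n))) (Block.gap-above Bv)

  ¬nonadj-closer-last-block : ∀ {z v} (z∉P : Off z) (v∉P : Off v) → z ~ q (suc k₂) ≡ true → Misses z q 1 (suc k₂) →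
    Block v v∉P (suc k₂) → z ~ v ≡ false → ⊥
  ¬nonadj-closer-last-block {z} {v} z∉P v∉P h gap Bv zv =
    Attach.R.¬pendant-at-triangle z z∉P v (≤-trans room (n≤1+n _)) h (gap k₂ 1≤k₂ (n<1+n k₂))
      (Misses-narrow (s≤s z≤n) room (Misses-mirror gap refl (+-comm (suc k₂) 1))) zv (Block.hit Bv) (Block.hit-below Bv refl)
      (Misses-mirror {s₀ = 0} (λ i _ i<k₂ → Block.gap-below Bv i (s≤s i<k₂)) refl (+-comm k₂ 2))

  ¬adj-closer-inner-block : ∀ {z v} (z∉P : Off z) (v∉P : Off v) j → 1 ≤ j → j ≤ k₂ →
    z ~ q 0 ≡ true → z ~ q (suc k₂) ≡ true → Misses z q 1 (suc k₂) → Block v v∉P j → z ~ v ≡ true → ⊥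
  ¬adj-closer-inner-block {z} {v} z∉P v∉P j 1≤j j≤k₂ h₀ h gap Bv zv with j ≟ 1 | j ≟ k₂
  ... | yes refl | _ = Swapped.¬hh-h (swap-in v∉P 1 Bv) z (∉-swap z∉P v≢z) 0 (suc k₂) room<k₂+1 last<k
          (sees-other 1 v (λ ()) h₀) (sees-swapped 1 v zv)
          (misses-swapped 1 v (λ t 2≤t t<2+m _ → gap t (≤-trans (s≤s z≤n) 2≤t) (<-≤-trans t<2+m room))
            (λ 2≤1 _ → ⊥-elim (<-irrefl refl 2≤1)))
          (sees-other 1 v (λ e → <-irrefl (sym (suc-injective e)) 1≤k₂) h)
    where
      v≢z = λ e → ~⇒≢ zv (sym e)
      room<k₂+1 : suc (suc m) < suc k₂
      room<k₂+1 = ≤-pred (subst (_≤ k) (+-comm m 4) m+4≤k)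
  ... | no _ | yes refl = Swapped.¬end-edge (swap-in v∉P j Bv) z (∉-swap z∉P v≢z) j 2≤k₂ last<k
          (sees-other j v (λ { refl → <-irrefl refl 1≤j }) h₀)
          (misses-swapped j v (λ t 1≤t t<j _ → gap t 1≤t (<-trans t<j (n<1+n _))) (λ _ j<j → ⊥-elim (<-irrefl refl j<j)))
          (sees-swapped j v zv) (sees-other j v (λ ()) h) (misses-beyond ≤-refl)
    where
      v≢z = λ e → ~⇒≢ zv (sym e)
  ... | no j≢1 | no j≢k₂ = K13-free (inducedK13 z (q 0) (q (suc k₂)) v h₀ h zv (nonadj-far last<k (s≤s 1≤k₂))
          (~-symᶠ (Block.gap-below Bv 0 (≤∧≢⇒< 1≤j (λ e → j≢1 (sym e)))))
          (~-symᶠ (Block.gap-above Bv (suc k₂) (s≤s (≤∧≢⇒< j≤k₂ j≢k₂)) last<k))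
          (distinct (s≤s z≤n) last<k (λ ())) (λ e → v∉P (s≤s z≤n) e) (λ e → v∉P last<k e))

  ¬nonadj-closers : ∀ {z z′} (z∉P : Off z) (z′∉P : Off z′) → z ~ q 0 ≡ true → Misses z q 1 (suc k₂) →
    z′ ~ q 0 ≡ true → Misses z′ q 1 (suc k₂) → z ≢ z′ → z ~ z′ ≡ false → ⊥
  ¬nonadj-closers z∉P z′∉P h₀ gap h₀′ gap′ z≢z′ zz′ = K13-free (inducedK13 (q 0) _ _ (q 1) (~-symᵗ h₀) (~-symᵗ h₀′)
    (adj-next (s≤s (s≤s z≤n))) zz′ (gap 1 ≤-refl (s≤s 1≤k₂)) (gap′ 1 ≤-refl (s≤s 1≤k₂)) z≢z′
    (λ e → z∉P (s≤s (s≤s z≤n)) (sym e)) (λ e → z′∉P (s≤s (s≤s z≤n)) (sym e)))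

  index : ∀ {v} → Placed v → ℕ
  index (on-path j _ _) = j
  index (in-block _ j _ _) = j
  index (closer _ _ _ _) = k

  index-on-path : ∀ {j} → j < k → (p : Placed (q j)) → index p ≡ j
  index-on-path j<k (on-path i i<k e) = injective i<k j<k e
  index-on-path j<k (in-block v∉P _ _ _) = ⊥-elim (v∉P j<k refl)
  index-on-path j<k (closer v∉P _ _ _) = ⊥-elim (v∉P j<k refl)

  index<k⊎≡k : ∀ {v} (p : Placed v) → index p < k ⊎ index p ≡ k
  index<k⊎≡k (on-path _ j<k _) = inj₁ j<k
  index<k⊎≡k (in-block _ _ j<k _) = inj₁ j<k
  index<k⊎≡k (closer _ _ _ _) = inj₂ refl

  path-closer : ∀ {z} i → i < k → z ~ q 0 ≡ true → z ~ q (suc k₂) ≡ true → Misses z q 1 (suc k₂) →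
    q i ~ z ≡ true ⇔ NearCycle k i k
  path-closer {z} i i<k h₀ h gap = mk⇔ to from
    where
      to : q i ~ z ≡ true → NearCycle k i k
      to e with i ≟ 0 | i ≟ suc k₂
      ... | yes refl | _ = inj₂ (inj₁ (refl , refl))
      ... | no _ | yes refl = inj₁ (inj₂ (inj₁ refl))
      ... | no i≢0 | no i≢last = ⊥-elim (true≢false (trans (sym e)
            (~-symᶠ (gap i (≤∧≢⇒< z≤n (λ e′ → i≢0 (sym e′))) (≤∧≢⇒< (≤-pred i<k) i≢last)))))
      from : NearCycle k i k → q i ~ z ≡ true
      from (inj₁ (inj₁ refl)) = ⊥-elim (<-irrefl refl i<k)
      from (inj₁ (inj₂ (inj₁ refl))) = ~-symᵗ h
      from (inj₁ (inj₂ (inj₂ refl))) = ⊥-elim (<-irrefl refl (suc<⇒< i<k))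
      from (inj₂ (inj₁ (refl , _))) = ~-symᵗ h₀
      from (inj₂ (inj₂ (refl , _))) = ⊥-elim (<-irrefl refl i<k)

  path-block : ∀ {v} (v∉P : Off v) i j → i < k → Block v v∉P j → q i ~ v ≡ true ⇔ Near i j
  path-block {v} v∉P i j i<k B with i ≟ j
  ... | yes refl = mk⇔ (λ _ → inj₁ refl) (λ _ → ~-symᵗ (Block.hit B))
  ... | no i≢j = pathAdj-⇔ (trans (~-sym (q i) v) (Block.N≡pathAdj v v∉P B i<k i≢j)) i≢j

  block-block : ∀ {u v} (u∉P : Off u) (v∉P : Off v) i j → i < k → j < k → Block u u∉P i → Block v v∉P j →
    u ≢ v → u ~ v ≡ true ⇔ Near i j
  block-block {u} {v} u∉P v∉P i j i<k j<k Bu Bv u≢v = mk⇔ to from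
    where
      to : u ~ v ≡ true → Near i j
      to e with near-or-far i j
      ... | inj₁ near = near
      ... | inj₂ (inj₁ far) = ⊥-elim (¬adj-distant-blocks u∉P v∉P i j j<k far Bu Bv u≢v e)
      ... | inj₂ (inj₂ far) = ⊥-elim (¬adj-distant-blocks v∉P u∉P j i i<k far Bv Bu (λ e′ → u≢v (sym e′)) (~-symᵗ e))
      from : Near i j → u ~ v ≡ true
      from (inj₁ refl) = Boolₚ.¬-not (¬nonadj-same-block u∉P v∉P i i<k Bu Bv u≢v)
      from (inj₂ (inj₁ refl)) = Boolₚ.¬-not (¬nonadj-next-block u∉P v∉P i j<k Bu Bv u≢v)
      from (inj₂ (inj₂ refl)) = Boolₚ.¬-not λ f →
        ¬nonadj-next-block v∉P u∉P j i<k Bv Bu (λ e → u≢v (sym e)) (~-symᶠ f)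

  block-closer : ∀ {v z} (v∉P : Off v) (z∉P : Off z) j → j < k → Block v v∉P j →
    z ~ q 0 ≡ true → z ~ q (suc k₂) ≡ true → Misses z q 1 (suc k₂) → v ~ z ≡ true ⇔ NearCycle k j k
  block-closer {v} {z} v∉P z∉P j j<k B h₀ h gap = mk⇔ to from
    where
      to : v ~ z ≡ true → NearCycle k j k
      to e with j ≟ 0 | j ≟ suc k₂
      ... | yes refl | _ = inj₂ (inj₁ (refl , refl))
      ... | no _ | yes refl = inj₁ (inj₂ (inj₁ refl))
      ... | no j≢0 | no j≢last = ⊥-elim (¬adj-closer-inner-block z∉P v∉P j (≤∧≢⇒< z≤n (λ e′ → j≢0 (sym e′)))
            (≤-pred (≤∧≢⇒< (≤-pred j<k) j≢last)) h₀ h gap B (~-symᵗ e))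
      from : NearCycle k j k → v ~ z ≡ true
      from (inj₁ (inj₁ refl)) = ⊥-elim (<-irrefl refl j<k)
      from (inj₁ (inj₂ (inj₁ refl))) = Boolₚ.¬-not λ f → ¬nonadj-closer-last-block z∉P v∉P h gap B (~-symᶠ f)
      from (inj₁ (inj₂ (inj₂ refl))) = ⊥-elim (<-irrefl refl (suc<⇒< j<k))
      from (inj₂ (inj₁ (refl , _))) = Boolₚ.¬-not λ f → ¬nonadj-closer-first-block z∉P v∉P h₀ gap B (~-symᶠ f)
      from (inj₂ (inj₂ (refl , _))) = ⊥-elim (<-irrefl refl j<k)

  swap-⇔ : ∀ {u v i j} → v ~ u ≡ true ⇔ NearCycle k j i → u ~ v ≡ true ⇔ NearCycle k i j
  swap-⇔ {u} {v} vu = mk⇔ (λ e → NearCycle-sym (Equivalence.to vu (~-symᵗ e)))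
                          (λ near → ~-symᵗ (Equivalence.from vu (NearCycle-sym near)))

  below-k : ∀ {b i j} → i < k → j < k → b ≡ true ⇔ Near i j → b ≡ true ⇔ NearCycle k i j
  below-k i<k j<k b⇔ = mk⇔ (λ e → inj₁ (Equivalence.to b⇔ e)) (λ near → Equivalence.from b⇔ (NearCycle⇒Near i<k j<k near))

  adjacency-by-index : ∀ {u v} (pu : Placed u) (pv : Placed v) → u ≢ v → u ~ v ≡ true ⇔ NearCycle k (index pu) (index pv)
  adjacency-by-index (on-path i i<k refl) (on-path j j<k refl) u≢v =
    below-k i<k j<k (pathAdj-⇔ (adjacency i<k j<k) (λ e → u≢v (cong q e)))
  adjacency-by-index (on-path i i<k refl) (in-block v∉P j j<k B) _ = below-k i<k j<k (path-block v∉P i j i<k B)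
  adjacency-by-index (on-path i i<k refl) (closer _ h₀ h gap) _ = path-closer i i<k h₀ h gap
  adjacency-by-index (in-block u∉P i i<k B) (on-path j j<k refl) _ = swap-⇔ (below-k j<k i<k (path-block u∉P j i j<k B))
  adjacency-by-index (in-block u∉P i i<k Bu) (in-block v∉P j j<k Bv) u≢v =
    below-k i<k j<k (block-block u∉P v∉P i j i<k j<k Bu Bv u≢v)
  adjacency-by-index (in-block v∉P j j<k B) (closer z∉P h₀ h gap) _ = block-closer v∉P z∉P j j<k B h₀ h gap
  adjacency-by-index (closer _ h₀ h gap) (on-path j j<k refl) _ = swap-⇔ (path-closer j j<k h₀ h gap)
  adjacency-by-index (closer z∉P h₀ h gap) (in-block v∉P j j<k B) _ = swap-⇔ (block-closer v∉P z∉P j j<k B h₀ h gap)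
  adjacency-by-index (closer z∉P h₀ _ gap) (closer z′∉P h₀′ _ gap′) z≢z′ =
    mk⇔ (λ _ → inj₁ (inj₁ refl)) (λ _ → Boolₚ.¬-not (¬nonadj-closers z∉P z′∉P h₀ gap h₀′ gap′ z≢z′))

  fat-path : (placed : ∀ v → Placed v) → (∀ v → index (placed v) < k) → IsFatPath k G
  fat-path placed index<k = block , surjective , λ u v u≢v → mk⇔
      (λ e → subst₂ Near (sym (block-index u)) (sym (block-index v))
               (NearCycle⇒Near (index<k u) (index<k v) (Equivalence.to (adjacency-by-index (placed u) (placed v) u≢v) e)))
      (λ near → Equivalence.from (adjacency-by-index (placed u) (placed v) u≢v)
                  (inj₁ (subst₂ Near (block-index u) (block-index v) near)))
    where
      block : V → Fin k
      block v = fromℕ< (index<k v)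
      block-index : ∀ v → toℕ (block v) ≡ index (placed v)
      block-index v = Finₚ.toℕ-fromℕ< (index<k v)
      surjective : ∀ b → ∃ λ v → ∀ {w} → w ≡ v → block w ≡ b
      surjective b = q (toℕ b) , λ { refl → Finₚ.toℕ-injective
        (trans (block-index _) (index-on-path (Finₚ.toℕ<n b) (placed (q (toℕ b))))) }

  fat-cycle : (placed : ∀ v → Placed v) → ∀ z → index (placed z) ≡ k → IsFatCycle k G
  fat-cycle placed z index-z = block , surjective , λ u v u≢v → mk⇔
      (λ e → subst₂ (NearCycle k) (sym (block-index u)) (sym (block-index v))
               (Equivalence.to (adjacency-by-index (placed u) (placed v) u≢v) e))
      (λ near → Equivalence.from (adjacency-by-index (placed u) (placed v) u≢v)
                  (subst₂ (NearCycle k) (block-index u) (block-index v) near))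
    where
      index≤k : ∀ v → index (placed v) ≤ k
      index≤k v with index<k⊎≡k (placed v)
      ... | inj₁ i<k = <⇒≤ i<k
      ... | inj₂ i≡k = ≤-reflexive i≡k
      block : V → Fin (suc k)
      block v = fromℕ< (s≤s (index≤k v))
      block-index : ∀ v → toℕ (block v) ≡ index (placed v)
      block-index v = Finₚ.toℕ-fromℕ< (s≤s (index≤k v))
      surjective : ∀ b → ∃ λ v → ∀ {w} → w ≡ v → block w ≡ b
      surjective b with toℕ b <? k
      ... | yes b<k = q (toℕ b) , λ { refl → Finₚ.toℕ-injective
            (trans (block-index _) (index-on-path b<k (placed (q (toℕ b))))) }
      ... | no b≮k = z , λ { refl → Finₚ.toℕ-injective
            (trans (block-index z) (trans index-z (≤-antisym (≮⇒≥ b≮k) (≤-pred (Finₚ.toℕ<n b))))) }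

  fat : (∀ v → Placed v) → IsFatPath k G ⊎ IsFatCycle k G
  fat placed with find-or-all (λ v → index (placed v) ≡ k) (λ v → index (placed v) < k)
                    (λ v → [ inj₂ , inj₁ ]′ (index<k⊎≡k (placed v)))
  ... | inj₁ (z , index-z) = inj₂ (fat-cycle placed z index-z)
  ... | inj₂ index<k = inj₁ (fat-path placed index<k)

  longer-or-fat : Connected G → Longer ⊎ (IsFatPath k G ⊎ IsFatCycle k G)
  longer-or-fat connected with find-or-all (λ v → Longer ⊎ (Off v × Far v)) Placed classify
  ... | inj₂ placed = inj₂ (fat placed)
  ... | inj₁ (v , inj₁ longer) = inj₁ longer
  ... | inj₁ (v , inj₂ (v∉P , v-far)) with walk (connected (q 0) v) (on-path 0 (s≤s z≤n) refl) v-far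
  ...   | inj₁ longer = inj₁ longer
  ...   | inj₂ (u , w , placed , w∉P , w-far , uw) = inj₁ (extend-at-edge u w placed w∉P w-far uw)

≡-by-⇔ : ∀ {b c : Bool} {A : Set} → b ≡ true ⇔ A → c ≡ true ⇔ A → b ≡ c
≡-by-⇔ {true} {true} _ _ = refl
≡-by-⇔ {false} {false} _ _ = refl
≡-by-⇔ {true} {false} b⇔ c⇔ = sym (Equivalence.from c⇔ (Equivalence.to b⇔ refl))
≡-by-⇔ {false} {true} b⇔ c⇔ = Equivalence.from b⇔ (Equivalence.to c⇔ refl)

module FatGraphs (G : Graph) where

  open GraphTheory G

  transversal-path : ∀ {K} l → l ≤ K → (block : V → Fin K) → Surjective _≡_ _≡_ block →
    (R : Fin K → Fin K → Set) → (∀ u v → u ≢ v → (u ~ v ≡ true ⇔ R (block u) (block v))) →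
    (∀ a b → toℕ a < l → toℕ b < l → R a b ⇔ NearP a b) → InducedSub (Path l) G
  transversal-path {K} l l≤K block surjective R adj⇔R R⇔Near = f , injective , adjacency
    where
      t<K : ∀ (t : Fin l) → toℕ t < K
      t<K t = <-≤-trans (Finₚ.toℕ<n t) l≤K
      f : Fin l → V
      f t = proj₁ (surjective (fromℕ< (t<K t)))
      block-f : ∀ t → toℕ (block (f t)) ≡ toℕ t
      block-f t = trans (cong toℕ (proj₂ (surjective (fromℕ< (t<K t))) refl)) (Finₚ.toℕ-fromℕ< (t<K t))
      injective : ∀ {a b} → f a ≡ f b → a ≡ b
      injective {a} {b} e = Finₚ.toℕ-injective (trans (sym (block-f a)) (trans (cong (λ v → toℕ (block v)) e) (block-f b)))
      f-adj : ∀ {a b} → f a ≢ f b → f a ~ f b ≡ true ⇔ NearP a b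
      f-adj {a} {b} fa≢fb = mk⇔
        (λ e → subst₂ Near (block-f a) (block-f b) (Equivalence.to (R⇔Near _ _ (bound a) (bound b)) (Equivalence.to (adj⇔R _ _ fa≢fb) e)))
        (λ near → Equivalence.from (adj⇔R _ _ fa≢fb) (Equivalence.from (R⇔Near _ _ (bound a) (bound b))
                    (subst₂ Near (sym (block-f a)) (sym (block-f b)) near)))
        where
          bound : ∀ t → toℕ (block (f t)) < l
          bound t = subst (_< l) (sym (block-f t)) (Finₚ.toℕ<n t)
      adjacency : ∀ a b → f a ~ f b ≡ adj (Path l) a b
      adjacency a b with a Finₚ.≟ b
      ... | yes refl = irrefl G (f a)
      ... | no a≢b = ≡-by-⇔ (f-adj (λ e → a≢b (injective e))) (pathAdj-⇔ refl λ e → a≢b (Finₚ.toℕ-injective e))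

  fat⇒path : ∀ l i → l ≤ i → IsFatPath i G ⊎ IsFatCycle i G → InducedSub (Path l) G
  fat⇒path l i l≤i (inj₁ (block , surjective , adj⇔)) =
    transversal-path l l≤i block surjective NearP adj⇔ (λ _ _ _ _ → mk⇔ (λ near → near) (λ near → near))
  fat⇒path l i l≤i (inj₂ (block , surjective , adj⇔)) =
    transversal-path l (≤-trans l≤i (n≤1+n i)) block surjective NearC adj⇔
      (λ _ _ a<l b<l → mk⇔ (NearCycle⇒Near (<-≤-trans a<l l≤i) (<-≤-trans b<l l≤i)) inj₁)

∃-Vec? : ∀ {n} l (P : Vec (Fin n) l → Set) → (∀ v → Dec (P v)) → Dec (∃ P)
∃-Vec? zero P P? with P? []
... | yes p = yes ([] , p)
... | no ¬p = no λ { ([] , p) → ¬p p }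
∃-Vec? (suc l) P P? with Finₚ.any? (λ x → ∃-Vec? l (λ w → P (x ∷ w)) (λ w → P? (x ∷ w)))
... | yes (x , w , p) = yes (x ∷ w , p)
... | no ¬p = no λ { (x ∷ w , p) → ¬p (x , w , p) }

induced? : (H G : Graph) → Dec (InducedSub H G)
induced? H G with ∃-Vec? (n H) Copy copy?
  where
    Copy : Vec (Fin (n G)) (n H) → Set
    Copy v = (∀ a b → lookup v a ≡ lookup v b → a ≡ b) × (∀ a b → adj G (lookup v a) (lookup v b) ≡ adj H a b)
    copy? : ∀ v → Dec (Copy v)
    copy? v = Finₚ.all? (λ a → Finₚ.all? λ b → (lookup v a Finₚ.≟ lookup v b) →-dec (a Finₚ.≟ b))
          ×-dec Finₚ.all? (λ a → Finₚ.all? λ b → adj G (lookup v a) (lookup v b) Boolₚ.≟ adj H a b)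
... | yes (v , injective , adjacency) = yes (lookup v , (λ {a} {b} → injective a b) , adjacency)
... | no ¬copy = no λ (f , injective , adjacency) → ¬copy (tabulate f ,
        (λ a b e → injective (trans (sym (lookup∘tabulate f a)) (trans e (lookup∘tabulate f b)))) ,
        (λ a b → trans (cong₂ (adj G) (lookup∘tabulate f a) (lookup∘tabulate f b)) (adjacency a b)))

module LongPaths (G : Graph) (m : ℕ) (1≤m : 1 ≤ m) (connected : Connected G)
  (K13-free : ¬ InducedSub K13 G) (B1-free : ¬ InducedSub (B1 m) G) where

  open GraphTheory G

  L : ℕ
  L = 3 * m ⊔ (m + 4)

  -- Each round lengthens the path, and an induced path has at most n G vertices.
  grow : ∀ fuel {k₂ q} → InducedPath (suc (suc k₂)) q → n G ≤ fuel + suc (suc k₂) → L ≤ suc (suc k₂) → InP L G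
  grow fuel {k₂} P bound L≤k
    with Growth.longer-or-fat G m 1≤m K13-free B1-free P
           (≤-trans (m≤m⊔n (3 * m) (m + 4)) L≤k) (≤-trans (m≤n⊔m (3 * m) (m + 4)) L≤k) connected
  ... | inj₂ fat = suc (suc k₂) , L≤k , fat
  ... | inj₁ (_ , P′) with fuel
  ...   | zero = ⊥-elim (<-irrefl refl (≤-trans (length≤order P′) bound))
  ...   | suc fuel = grow fuel P′ (subst (n G ≤_) (sym (+-suc fuel _)) bound) (≤-trans L≤k (n≤1+n _))

  path⇒fat : ∀ l → 2 ≤ l → L ≤ l → InducedSub (Path l) G → InP L G
  path⇒fat (suc zero) (s≤s ()) _ _
  path⇒fat (suc (suc k₂)) _ L≤l copy = grow (n G) (proj₂ (copy⇒path copy)) (m≤m+n (n G) _) L≤l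

  2≤L : 2 ≤ L
  2≤L = ≤-trans (≤-trans (s≤s (s≤s z≤n)) (m≤n+m 4 m)) (m≤n⊔m (3 * m) (m + 4))

theorem1p4 : (m : ℕ) → 1 ≤ m → (G : Graph) → Connected G →
    Free G K13 → Free G (B1 m) →
    ((¬ Free G (Path ((3 * m) ⊔ (m + 4)))) ⇔ InP ((3 * m) ⊔ (m + 4)) G)
theorem1p4 m 1≤m G connected K13-free B1-free = mk⇔
  (λ ¬free → path⇒fat L 2≤L ≤-refl (decidable-stable (induced? (Path L) G) ¬free))
  (λ (i , L≤i , fat) free → free (FatGraphs.fat⇒path G L i L≤i fat))
  where open LongPaths G m 1≤m connected K13-free B1-free
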